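{- Let $q=[a,b,c]$ be a primitive integral form of non-square discriminant $D>0$ with $a>0>c$, and let $w$ be the river sequence word read starting from $q$, with $M$ the corresponding product of the matrices $L$ and $R$ (in the order of the word), so that $q|M=q$. If $w=X\cdot\overline{X}$ for a word $X$, where $\overline X$ is obtained from $X$ by switching every $L$ and $R$, then $q|X=-q^*$ (where $X$ also denotes the corresponding matrix product), and writing $X=\begin{pmatrix}\alpha&\beta\\\gamma&\delta\end{pmatrix}$, the minimal positive integer solution $(t_*,u_*)$ of $t^2-Du^2=-4$ is $t_*=\beta+\gamma$, $u_*=\gcd(\delta,\gamma-\beta,\alpha)$. If $w$ is not of the form $X\cdot\overline X$, then $q\not\sim-q^*$ and $t^2-Du^2=-4$ has no integer solutions.
   Context: Forms $[a,b,c]=ax^2+bxy+cy^2$ have integer coefficients, discriminant $b^2-4ac$; primitive means $\gcd(a,b,c)=1$. For $M=\begin{pmatrix}\alpha&\beta\\\gamma&\delta\end{pmatrix}$, $q|M(x,y)=q(\alpha x+\beta y,\gamma x+\delta y)$; $q_1\sim q_2$ if $q_1=q_2|M$ for some $M\in\mathrm{SL}(2,\mathbb Z)$. For $q=[a,b,c]$, $q^*:=[c,b,a]$. $L=\begin{pmatrix}1&1\\0&1\end{pmatrix}$, $R=\begin{pmatrix}1&0\\1&1\end{pmatrix}$, so $q|L=[a,b+2a,a+b+c]$ and $q|R=[a+b+c,b+2c,c]$. River sequence from a form $q$ with $a>0>c$: set $q_0=q$; for $q_j=[a_j,b_j,c_j]$, if $a_j+b_j+c_j<0$ record $L$ and set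 $q_{j+1}=q_j|L$, if $a_j+b_j+c_j>0$ record $R$ and set $q_{j+1}=q_j|R$; stop at the first $j\ge1$ with $q_j=q$. The recorded word is $w$ (this is the sequence of left/right turns along the river of the topograph of $q$ over one period). -}

module Defs where

open import Data.Integer using (ℤ; +_; -_; _+_; _-_; _*_; _<_; _>_; _≤_; 0ℤ; 1ℤ; _<?_)
open import Data.Integer.GCD using (gcd)
open import Data.Nat using (ℕ; zero; suc)
import Data.Nat as ℕ
open import Data.List using (List; []; _∷_; _++_; map; foldr)
open import Data.Maybe using (Maybe; just; nothing)
open import Data.Product using (_×_; _,_; Σ; ∃; ∃-syntax)
open import Relation.Nullary using (¬_; yes; no)
open import Relation.Binary.PropositionalEquality using (_≡_; _≢_)

-- Binary quadratic form [a,b,c] = a x^2 + b x y + c y^2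
record Form : Set where
  constructor [_,_,_]
  field
    a b c : ℤ
open Form public

disc : Form → ℤ
disc [ a , b , c ] = b * b - (+ 4) * a * c

Primitive : Form → Set
Primitive [ a , b , c ] = gcd (gcd a b) c ≡ 1ℤ

IsSquare : ℤ → Set
IsSquare d = ∃[ k ] d ≡ k * k

record Mat : Set where
  constructor mat
  field
    α β γ δ : ℤ
open Mat public

_·_ : Mat → Mat → Mat
mat a₁ b₁ c₁ d₁ · mat a₂ b₂ c₂ d₂ =
  mat (a₁ * a₂ + b₁ * c₂) (a₁ * b₂ + b₁ * d₂) (c₁ * a₂ + d₁ * c₂) (c₁ * b₂ + d₁ * d₂)

I₂ : Mat
I₂ = mat 1ℤ 0ℤ 0ℤ 1ℤ

det : Mat → ℤ
det (mat p q r s) = p * s - q * r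

-- q|M (x,y) = q(αx+βy, γx+δy)
_∣ᶠ_ : Form → Mat → Form
[ a , b , c ] ∣ᶠ mat p q r s =
  [ a * p * p + b * p * r + c * r * r
  , (+ 2) * a * p * q + b * (p * s + q * r) + (+ 2) * c * r * s
  , a * q * q + b * q * s + c * s * s ]

_∼_ : Form → Form → Set
q₁ ∼ q₂ = ∃[ M ] (det M ≡ 1ℤ × q₁ ≡ q₂ ∣ᶠ M)

_* : Form → Form
[ a , b , c ] * = [ c , b , a ]

negF : Form → Form
negF [ a , b , c ] = [ - a , - b , - c ]

data Letter : Set where
  L R : Letter

matL : Mat
matL = mat 1ℤ 1ℤ 0ℤ 1ℤ

matR : Mat
matR = mat 1ℤ 0ℤ 1ℤ 1ℤ

letterMat : Letter → Mat
letterMat L = matL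
letterMat R = matR

wordMat : List Letter → Mat
wordMat = foldr (λ x M → letterMat x · M) I₂

swap : Letter → Letter
swap L = R
swap R = L

bar : List Letter → List Letter
bar = map swap

riverStep : Form → Maybe (Letter × Form)
riverStep q with a q + b q + c q <? 0ℤ | 0ℤ <? a q + b q + c q
... | yes _ | _ = just (L , q ∣ᶠ matL)
... | no _ | yes _ = just (R , q ∣ᶠ matR)
... | no _ | no _ = nothing

riverRun : ℕ → Form → Maybe (List Letter × Form)
riverRun zero q = just ([] , q)
riverRun (suc n) q with riverStep q
... | nothing = nothing
... | just (x , q') with riverRun n q'
...   | nothing = nothing
...   | just (w , q'') = just (x ∷ w , q'')

RiverWord : Form → List Letter → Set
RiverWord q w =
  Σ ℕ λ n → 1 ℕ.≤ n × riverRun n q ≡ just (w , q) ×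
    (∀ j (w' : List Letter) → 1 ℕ.≤ j → j ℕ.< n → riverRun j q ≢ just (w' , q))

PellSol : ℤ → ℤ → ℤ → Set
PellSol D t u = t * t - D * u * u ≡ - (+ 4)

IsMinPosPellSol : ℤ → ℤ → ℤ → Set
IsMinPosPellSol D t u =
  0ℤ < t × 0ℤ < u × PellSol D t u ×
  (∀ t' u' → 0ℤ < t' → 0ℤ < u' → PellSol D t' u' → t ≤ t' × u ≤ u')

-- The river of q is a periodic sequence of forms, and the automorph q|w = q is its period.
-- Exchanging L and R corresponds to q ↦ -q*, which maps the river onto itself with its banks
-- exchanged. A solution of t² - D u² = -4 with t = 2k + b u gives the matrix (-cu k ; k+bu au) of
-- SL₂(ℕ) sending q to -q*; it is a word in L and R, and a word joining two forms of the river
-- (a > 0 > c) must follow the river, since a wrong turn leads into a region where all values are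
-- of one sign for good. So -q* lies on the river of q iff such a solution exists, and
-- reaching -q* after m < n steps forces the period to be X X̄ with |X| = m. Conversely, if w = X X̄,
-- the form reached after X and -q* are both fixed by X̄X, whose lower-left entry is positive, so
-- they coincide. The entries of X then give the solution, and it is the least one because
-- every positive solution comes from a stretch of river starting with X, and matrix entries only
-- grow along the river.

module Submission where

open import Defs
open import Data.Integer hiding (suc; _≟_)
open import Data.Integer.Properties
open import Data.Integer.Tactic.RingSolver
open import Data.List using (List; []; _∷_; _++_; length)
open import Data.Maybe using (just; nothing)
open import Data.Nat using (ℕ; zero; suc; z≤n; s≤s)
import Data.Nat as ℕ
import Data.Nat.Properties as ℕₚ
open import Data.Nat.Induction using (<-wellFounded)
open import Induction.WellFounded using (Acc; acc)
import Data.List.Properties as Listₚ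
import Data.Nat.GCD as ℕGCD
import Data.Nat.Tactic.RingSolver as ℕSolver
open import Data.Integer.DivMod using (_/ℕ_; _%ℕ_; a≡a%ℕn+[a/ℕn]*n; n%ℕd<d)
open import Data.Integer.GCD using (gcd)
open import Data.Sum using (_⊎_; inj₁; inj₂)
open import Data.Empty using (⊥; ⊥-elim)
open import Relation.Nullary using (¬_; yes; no)
open import Relation.Binary using (tri<; tri≈; tri>)
open import Data.Product using (∃-syntax; _×_; _,_; proj₁; proj₂)
open import Relation.Binary.PropositionalEquality hiding ([_])

i≡-j⇒i+j≡0 : ∀ {i j} → i ≡ - j → i + j ≡ 0ℤ
i≡-j⇒i+j≡0 {j = j} refl = +-inverseˡ j

i+j≡0⇒j≡-i : ∀ {i j} → i + j ≡ 0ℤ → j ≡ - i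
i+j≡0⇒j≡-i {i} {j} i+j≡0 = begin
  j               ≡⟨ identity i j ⟩
  (i + j) + - i   ≡⟨ cong (_+ - i) i+j≡0 ⟩
  0ℤ + - i        ≡⟨ +-identityˡ (- i) ⟩
  - i             ∎
  where
  open ≡-Reasoning
  identity : ∀ i j → j ≡ (i + j) + - i
  identity = solve-∀

2*i≡0⇒i≡0 : ∀ {i} → (+ 2) * i ≡ 0ℤ → i ≡ 0ℤ
2*i≡0⇒i≡0 {i} 2i≡0 with i*j≡0⇒i≡0∨j≡0 (+ 2) 2i≡0
... | inj₂ i≡0 = i≡0

*-cancelˡ-pos : ∀ {i j k} → 0ℤ < i → i * j ≡ i * k → j ≡ k
*-cancelˡ-pos {i} {j} {k} 0<i = *-cancelˡ-≡ i j k {{>-nonZero 0<i}}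

pos*j≡0⇒j≡0 : ∀ {i j} → 0ℤ < i → i * j ≡ 0ℤ → j ≡ 0ℤ
pos*j≡0⇒j≡0 {i} {j} 0<i ij≡0 = *-cancelˡ-pos 0<i (trans ij≡0 (sym (*-zeroʳ i)))

combination≡0 : ∀ x y z {u v w} → u ≡ 0ℤ → v ≡ 0ℤ → w ≡ 0ℤ → x * u + y * v + z * w ≡ 0ℤ
combination≡0 x y z refl refl refl = identity x y z
  where
  identity : ∀ x y z → x * 0ℤ + y * 0ℤ + z * 0ℤ ≡ 0ℤ
  identity = solve-∀

combination₂≡0 : ∀ x y {u v} → u ≡ 0ℤ → v ≡ 0ℤ → x * u + y * v ≡ 0ℤ
combination₂≡0 x y refl refl = identity x y
  where
  identity : ∀ x y → x * 0ℤ + y * 0ℤ ≡ 0ℤ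
  identity = solve-∀

1≤i⇒0≤i : ∀ {i} → 1ℤ ≤ i → 0ℤ ≤ i
1≤i⇒0≤i = ≤-trans (+≤+ z≤n)

∣i∣≡∣j∣⇒i≡±j : ∀ {i j} → ∣ i ∣ ≡ ∣ j ∣ → i ≡ j ⊎ i ≡ - j
∣i∣≡∣j∣⇒i≡±j {i} {j} |i|≡|j| with +∣i∣≡i⊎+∣i∣≡-i i | +∣i∣≡i⊎+∣i∣≡-i j
... | inj₁ i≥0 | inj₁ j≥0 = inj₁ (trans (sym i≥0) (trans (cong +_ |i|≡|j|) j≥0))
... | inj₁ i≥0 | inj₂ j≤0 = inj₂ (trans (sym i≥0) (trans (cong +_ |i|≡|j|) j≤0))
... | inj₂ i≤0 | inj₁ j≥0 = inj₂ (trans (sym (neg-involutive i)) (cong -_ (trans (sym i≤0) (trans (cong +_ |i|≡|j|) j≥0))))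
... | inj₂ i≤0 | inj₂ j≤0 = inj₁ (neg-injective (trans (sym i≤0) (trans (cong +_ |i|≡|j|) j≤0)))

2*i≢-1 : ∀ i → (+ 2) * i ≢ - 1ℤ
2*i≢-1 (+ zero) ()
2*i≢-1 (+ suc n) ()
2*i≢-1 -[1+ zero ] ()
2*i≢-1 -[1+ suc n ] ()

0≤i*j∧0≤i+j⇒0≤i∧0≤j : ∀ i j → 0ℤ ≤ i * j → 0ℤ ≤ i + j → 0ℤ ≤ i × 0ℤ ≤ j
0≤i*j∧0≤i+j⇒0≤i∧0≤j (+ m) (+ n) _ _ = +≤+ z≤n , +≤+ z≤n
0≤i*j∧0≤i+j⇒0≤i∧0≤j (+ zero) -[1+ n ] _ ()
0≤i*j∧0≤i+j⇒0≤i∧0≤j (+ suc m) -[1+ n ] () _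
0≤i*j∧0≤i+j⇒0≤i∧0≤j -[1+ m ] (+ zero) _ ()
0≤i*j∧0≤i+j⇒0≤i∧0≤j -[1+ m ] (+ suc n) () _
0≤i*j∧0≤i+j⇒0≤i∧0≤j -[1+ m ] -[1+ n ] _ ()

-- Matrices acting on forms

Form-≡ : ∀ {a b c a′ b′ c′} → a ≡ a′ → b ≡ b′ → c ≡ c′ → [ a , b , c ] ≡ [ a′ , b′ , c′ ]
Form-≡ refl refl refl = refl

Mat-≡ : ∀ {p q r s p′ q′ r′ s′} → p ≡ p′ → q ≡ q′ → r ≡ r′ → s ≡ s′ → mat p q r s ≡ mat p′ q′ r′ s′
Mat-≡ refl refl refl refl = refl

∣ᶠ-· : ∀ f A B → (f ∣ᶠ A) ∣ᶠ B ≡ f ∣ᶠ (A · B)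
∣ᶠ-· [ a , b , c ] (mat p q r s) (mat p′ q′ r′ s′) =
  Form-≡ (coeff₀ a b c p q r s p′ q′ r′ s′) (coeff₁ a b c p q r s p′ q′ r′ s′) (coeff₂ a b c p q r s p′ q′ r′ s′)
  where
  coeff₀ : ∀ a b c p q r s p′ q′ r′ s′ →
    let a₁ = a * p * p + b * p * r + c * r * r
        b₁ = (+ 2) * a * p * q + b * (p * s + q * r) + (+ 2) * c * r * s
        c₁ = a * q * q + b * q * s + c * s * s
        p″ = p * p′ + q * r′
        r″ = r * p′ + s * r′
    in a₁ * p′ * p′ + b₁ * p′ * r′ + c₁ * r′ * r′ ≡ a * p″ * p″ + b * p″ * r″ + c * r″ * r″
  coeff₀ = solve-∀
  coeff₁ : ∀ a b c p q r s p′ q′ r′ s′ →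
    let a₁ = a * p * p + b * p * r + c * r * r
        b₁ = (+ 2) * a * p * q + b * (p * s + q * r) + (+ 2) * c * r * s
        c₁ = a * q * q + b * q * s + c * s * s
        p″ = p * p′ + q * r′
        q″ = p * q′ + q * s′
        r″ = r * p′ + s * r′
        s″ = r * q′ + s * s′
    in (+ 2) * a₁ * p′ * q′ + b₁ * (p′ * s′ + q′ * r′) + (+ 2) * c₁ * r′ * s′
       ≡ (+ 2) * a * p″ * q″ + b * (p″ * s″ + q″ * r″) + (+ 2) * c * r″ * s″
  coeff₁ = solve-∀
  coeff₂ : ∀ a b c p q r s p′ q′ r′ s′ →
    let a₁ = a * p * p + b * p * r + c * r * r
        b₁ = (+ 2) * a * p * q + b * (p * s + q * r) + (+ 2) * c * r * s
        c₁ = a * q * q + b * q * s + c * s * s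
        q″ = p * q′ + q * s′
        s″ = r * q′ + s * s′
    in a₁ * q′ * q′ + b₁ * q′ * s′ + c₁ * s′ * s′ ≡ a * q″ * q″ + b * q″ * s″ + c * s″ * s″
  coeff₂ = solve-∀

∣ᶠ-I₂ : ∀ f → f ∣ᶠ I₂ ≡ f
∣ᶠ-I₂ [ a , b , c ] = Form-≡ (coeff₀ a b c) (coeff₁ a b c) (coeff₂ a b c)
  where
  coeff₀ : ∀ a b c → a * 1ℤ * 1ℤ + b * 1ℤ * 0ℤ + c * 0ℤ * 0ℤ ≡ a
  coeff₀ = solve-∀
  coeff₁ : ∀ a b c → (+ 2) * a * 1ℤ * 0ℤ + b * (1ℤ * 1ℤ + 0ℤ * 0ℤ) + (+ 2) * c * 0ℤ * 1ℤ ≡ b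
  coeff₁ = solve-∀
  coeff₂ : ∀ a b c → a * 0ℤ * 0ℤ + b * 0ℤ * 1ℤ + c * 1ℤ * 1ℤ ≡ c
  coeff₂ = solve-∀

·-assoc : ∀ A B C → (A · B) · C ≡ A · (B · C)
·-assoc (mat p q r s) (mat p′ q′ r′ s′) (mat p″ q″ r″ s″) =
  Mat-≡ (entry p q p′ q′ r′ s′ p″ r″) (entry p q p′ q′ r′ s′ q″ s″)
        (entry r s p′ q′ r′ s′ p″ r″) (entry r s p′ q′ r′ s′ q″ s″)
  where
  entry : ∀ x y p′ q′ r′ s′ u v →
    (x * p′ + y * r′) * u + (x * q′ + y * s′) * v ≡ x * (p′ * u + q′ * v) + y * (r′ * u + s′ * v)
  entry = solve-∀

I₂-· : ∀ A → I₂ · A ≡ A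
I₂-· (mat p q r s) = Mat-≡ (top p r) (top q s) (bottom p r) (bottom q s)
  where
  top : ∀ x y → 1ℤ * x + 0ℤ * y ≡ x
  top = solve-∀
  bottom : ∀ x y → 0ℤ * x + 1ℤ * y ≡ y
  bottom = solve-∀

det-· : ∀ A B → det (A · B) ≡ det A * det B
det-· (mat p q r s) (mat p′ q′ r′ s′) = identity p q r s p′ q′ r′ s′
  where
  identity : ∀ p q r s p′ q′ r′ s′ →
    (p * p′ + q * r′) * (r * q′ + s * s′) - (p * q′ + q * s′) * (r * p′ + s * r′)
    ≡ (p * s - q * r) * (p′ * s′ - q′ * r′)
  identity = solve-∀

disc-∣ᶠ : ∀ f M → disc (f ∣ᶠ M) ≡ det M * det M * disc f
disc-∣ᶠ [ a , b , c ] (mat p q r s) = identity a b c p q r s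
  where
  identity : ∀ a b c p q r s →
    let a₁ = a * p * p + b * p * r + c * r * r
        b₁ = (+ 2) * a * p * q + b * (p * s + q * r) + (+ 2) * c * r * s
        c₁ = a * q * q + b * q * s + c * s * s
    in b₁ * b₁ - (+ 4) * a₁ * c₁ ≡ (p * s - q * r) * (p * s - q * r) * (b * b - (+ 4) * a * c)
  identity = solve-∀

disc-∣ᶠ-SL : ∀ f M → det M ≡ 1ℤ → disc (f ∣ᶠ M) ≡ disc f
disc-∣ᶠ-SL f M detM≡1 = begin
  disc (f ∣ᶠ M)               ≡⟨ disc-∣ᶠ f M ⟩
  det M * det M * disc f      ≡⟨ cong (λ d → d * d * disc f) detM≡1 ⟩
  1ℤ * 1ℤ * disc f            ≡⟨ *-identityˡ (disc f) ⟩
  disc f                      ∎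
  where open ≡-Reasoning

∣ᶠ-matL : ∀ f → f ∣ᶠ matL ≡ [ a f , b f + (+ 2) * a f , a f + b f + c f ]
∣ᶠ-matL [ a , b , c ] = Form-≡ (coeff₀ a b c) (coeff₁ a b c) (coeff₂ a b c)
  where
  coeff₀ : ∀ a b c → a * 1ℤ * 1ℤ + b * 1ℤ * 0ℤ + c * 0ℤ * 0ℤ ≡ a
  coeff₀ = solve-∀
  coeff₁ : ∀ a b c → (+ 2) * a * 1ℤ * 1ℤ + b * (1ℤ * 1ℤ + 1ℤ * 0ℤ) + (+ 2) * c * 0ℤ * 1ℤ ≡ b + (+ 2) * a
  coeff₁ = solve-∀
  coeff₂ : ∀ a b c → a * 1ℤ * 1ℤ + b * 1ℤ * 1ℤ + c * 1ℤ * 1ℤ ≡ a + b + c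
  coeff₂ = solve-∀

∣ᶠ-matR : ∀ f → f ∣ᶠ matR ≡ [ a f + b f + c f , b f + (+ 2) * c f , c f ]
∣ᶠ-matR [ a , b , c ] = Form-≡ (coeff₀ a b c) (coeff₁ a b c) (coeff₂ a b c)
  where
  coeff₀ : ∀ a b c → a * 1ℤ * 1ℤ + b * 1ℤ * 1ℤ + c * 1ℤ * 1ℤ ≡ a + b + c
  coeff₀ = solve-∀
  coeff₁ : ∀ a b c → (+ 2) * a * 1ℤ * 0ℤ + b * (1ℤ * 1ℤ + 0ℤ * 1ℤ) + (+ 2) * c * 1ℤ * 1ℤ ≡ b + (+ 2) * c
  coeff₁ = solve-∀
  coeff₂ : ∀ a b c → a * 0ℤ * 0ℤ + b * 0ℤ * 1ℤ + c * 1ℤ * 1ℤ ≡ c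
  coeff₂ = solve-∀

negDual : Form → Form
negDual f = negF (f *)

negDual-involutive : ∀ f → negDual (negDual f) ≡ f
negDual-involutive [ a , b , c ] = Form-≡ (neg-involutive a) (neg-involutive b) (neg-involutive c)

disc-negDual : ∀ f → disc (negDual f) ≡ disc f
disc-negDual [ a , b , c ] = identity a b c
  where
  identity : ∀ a b c → (- b) * (- b) - (+ 4) * (- c) * (- a) ≡ b * b - (+ 4) * a * c
  identity = solve-∀

negDual-∣ᶠ-matL : ∀ f → negDual f ∣ᶠ matL ≡ negDual (f ∣ᶠ matR)
negDual-∣ᶠ-matL [ a , b , c ] = Form-≡ (coeff₀ a b c) (coeff₁ a b c) (coeff₂ a b c)
  where
  coeff₀ : ∀ a b c → (- c) * 1ℤ * 1ℤ + (- b) * 1ℤ * 0ℤ + (- a) * 0ℤ * 0ℤ ≡ - (a * 0ℤ * 0ℤ + b * 0ℤ * 1ℤ + c * 1ℤ * 1ℤ)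
  coeff₀ = solve-∀
  coeff₁ : ∀ a b c → (+ 2) * (- c) * 1ℤ * 1ℤ + (- b) * (1ℤ * 1ℤ + 1ℤ * 0ℤ) + (+ 2) * (- a) * 0ℤ * 1ℤ
                     ≡ - ((+ 2) * a * 1ℤ * 0ℤ + b * (1ℤ * 1ℤ + 0ℤ * 1ℤ) + (+ 2) * c * 1ℤ * 1ℤ)
  coeff₁ = solve-∀
  coeff₂ : ∀ a b c → (- c) * 1ℤ * 1ℤ + (- b) * 1ℤ * 1ℤ + (- a) * 1ℤ * 1ℤ ≡ - (a * 1ℤ * 1ℤ + b * 1ℤ * 1ℤ + c * 1ℤ * 1ℤ)
  coeff₂ = solve-∀

negDual-∣ᶠ-matR : ∀ f → negDual f ∣ᶠ matR ≡ negDual (f ∣ᶠ matL)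
negDual-∣ᶠ-matR [ a , b , c ] = Form-≡ (coeff₀ a b c) (coeff₁ a b c) (coeff₂ a b c)
  where
  coeff₀ : ∀ a b c → (- c) * 1ℤ * 1ℤ + (- b) * 1ℤ * 1ℤ + (- a) * 1ℤ * 1ℤ ≡ - (a * 1ℤ * 1ℤ + b * 1ℤ * 1ℤ + c * 1ℤ * 1ℤ)
  coeff₀ = solve-∀
  coeff₁ : ∀ a b c → (+ 2) * (- c) * 1ℤ * 0ℤ + (- b) * (1ℤ * 1ℤ + 0ℤ * 1ℤ) + (+ 2) * (- a) * 1ℤ * 1ℤ
                     ≡ - ((+ 2) * a * 1ℤ * 1ℤ + b * (1ℤ * 1ℤ + 1ℤ * 0ℤ) + (+ 2) * c * 0ℤ * 1ℤ)
  coeff₁ = solve-∀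
  coeff₂ : ∀ a b c → (- c) * 0ℤ * 0ℤ + (- b) * 0ℤ * 1ℤ + (- a) * 1ℤ * 1ℤ ≡ - (a * 1ℤ * 1ℤ + b * 1ℤ * 0ℤ + c * 0ℤ * 0ℤ)
  coeff₂ = solve-∀

colSwap : Mat → Mat
colSwap (mat p q r s) = mat q p s r

∣ᶠ-colSwap : ∀ f M → f ∣ᶠ colSwap M ≡ (f ∣ᶠ M) *
∣ᶠ-colSwap [ a , b , c ] (mat p q r s) = Form-≡ refl (coeff₁ a b c p q r s) refl
  where
  coeff₁ : ∀ a b c p q r s → (+ 2) * a * q * p + b * (q * r + p * s) + (+ 2) * c * s * r
                             ≡ (+ 2) * a * p * q + b * (p * s + q * r) + (+ 2) * c * r * s
  coeff₁ = solve-∀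

det-colSwap : ∀ M → det (colSwap M) ≡ - det M
det-colSwap (mat p q r s) = identity p q r s
  where
  identity : ∀ p q r s → q * r - p * s ≡ - (p * s - q * r)
  identity = solve-∀

adj : Mat → Mat
adj (mat p q r s) = mat s (- q) (- r) p

·-adj : ∀ M → det M ≡ 1ℤ → M · adj M ≡ I₂
·-adj (mat p q r s) det≡1 = Mat-≡ (trans (diagonal₁ p q r s) det≡1) (off-diagonal₁ p q) (off-diagonal₂ r s) (trans (diagonal₂ p q r s) det≡1)
  where
  diagonal₁ : ∀ p q r s → p * s + q * (- r) ≡ p * s - q * r
  diagonal₁ = solve-∀
  off-diagonal₁ : ∀ p q → p * (- q) + q * p ≡ 0ℤ
  off-diagonal₁ = solve-∀
  off-diagonal₂ : ∀ r s → r * s + s * (- r) ≡ 0ℤ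
  off-diagonal₂ = solve-∀
  diagonal₂ : ∀ p q r s → r * (- q) + s * p ≡ p * s - q * r
  diagonal₂ = solve-∀

det-adj : ∀ M → det (adj M) ≡ det M
det-adj (mat p q r s) = identity p q r s
  where
  identity : ∀ p q r s → s * p - (- q) * (- r) ≡ p * s - q * r
  identity = solve-∀

wordMat-++ : ∀ U V → wordMat (U ++ V) ≡ wordMat U · wordMat V
wordMat-++ [] V = sym (I₂-· (wordMat V))
wordMat-++ (x ∷ U) V = begin
  letterMat x · wordMat (U ++ V)            ≡⟨ cong (letterMat x ·_) (wordMat-++ U V) ⟩
  letterMat x · (wordMat U · wordMat V)     ≡⟨ sym (·-assoc (letterMat x) (wordMat U) (wordMat V)) ⟩
  (letterMat x · wordMat U) · wordMat V     ∎
  where open ≡-Reasoning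

∣ᶠ-wordMat-++ : ∀ f U V → f ∣ᶠ wordMat (U ++ V) ≡ (f ∣ᶠ wordMat U) ∣ᶠ wordMat V
∣ᶠ-wordMat-++ f U V = trans (cong (f ∣ᶠ_) (wordMat-++ U V)) (sym (∣ᶠ-· f (wordMat U) (wordMat V)))

∣ᶠ-wordMat-∷ : ∀ f x W → f ∣ᶠ wordMat (x ∷ W) ≡ (f ∣ᶠ letterMat x) ∣ᶠ wordMat W
∣ᶠ-wordMat-∷ f x W = sym (∣ᶠ-· f (letterMat x) (wordMat W))

det-wordMat : ∀ W → det (wordMat W) ≡ 1ℤ
det-wordMat [] = refl
det-wordMat (x ∷ W) = begin
  det (letterMat x · wordMat W)       ≡⟨ det-· (letterMat x) (wordMat W) ⟩
  det (letterMat x) * det (wordMat W) ≡⟨ cong (det (letterMat x) *_) (det-wordMat W) ⟩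
  det (letterMat x) * 1ℤ              ≡⟨ det-letterMat x ⟩
  1ℤ                                  ∎
  where
  open ≡-Reasoning
  det-letterMat : ∀ x → det (letterMat x) * 1ℤ ≡ 1ℤ
  det-letterMat L = refl
  det-letterMat R = refl

matL-· : ∀ M → matL · M ≡ mat (γ M + α M) (δ M + β M) (γ M) (δ M)
matL-· (mat p q r s) = Mat-≡ (top p r) (top q s) (bottom p r) (bottom q s)
  where
  top : ∀ x y → 1ℤ * x + 1ℤ * y ≡ y + x
  top = solve-∀
  bottom : ∀ x y → 0ℤ * x + 1ℤ * y ≡ y
  bottom = solve-∀

matR-· : ∀ M → matR · M ≡ mat (α M) (β M) (α M + γ M) (β M + δ M)
matR-· (mat p q r s) = Mat-≡ (top p r) (top q s) (bottom p r) (bottom q s)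
  where
  top : ∀ x y → 1ℤ * x + 0ℤ * y ≡ x
  top = solve-∀
  bottom : ∀ x y → 1ℤ * x + 1ℤ * y ≡ x + y
  bottom = solve-∀

swap-involutive : ∀ x → swap (swap x) ≡ x
swap-involutive L = refl
swap-involutive R = refl

bar-involutive : ∀ W → bar (bar W) ≡ W
bar-involutive [] = refl
bar-involutive (x ∷ W) = cong₂ _∷_ (swap-involutive x) (bar-involutive W)

negDual-∣ᶠ-letterMat : ∀ f x → negDual f ∣ᶠ letterMat (swap x) ≡ negDual (f ∣ᶠ letterMat x)
negDual-∣ᶠ-letterMat f L = negDual-∣ᶠ-matR f
negDual-∣ᶠ-letterMat f R = negDual-∣ᶠ-matL f

negDual-∣ᶠ-wordMat : ∀ f W → negDual f ∣ᶠ wordMat (bar W) ≡ negDual (f ∣ᶠ wordMat W)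
negDual-∣ᶠ-wordMat f [] = trans (∣ᶠ-I₂ (negDual f)) (cong negDual (sym (∣ᶠ-I₂ f)))
negDual-∣ᶠ-wordMat f (x ∷ W) = begin
  negDual f ∣ᶠ wordMat (swap x ∷ bar W)                ≡⟨ ∣ᶠ-wordMat-∷ (negDual f) (swap x) (bar W) ⟩
  (negDual f ∣ᶠ letterMat (swap x)) ∣ᶠ wordMat (bar W) ≡⟨ cong (_∣ᶠ wordMat (bar W)) (negDual-∣ᶠ-letterMat f x) ⟩
  negDual (f ∣ᶠ letterMat x) ∣ᶠ wordMat (bar W)        ≡⟨ negDual-∣ᶠ-wordMat (f ∣ᶠ letterMat x) W ⟩
  negDual ((f ∣ᶠ letterMat x) ∣ᶠ wordMat W)            ≡⟨ cong negDual (sym (∣ᶠ-wordMat-∷ f x W)) ⟩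
  negDual (f ∣ᶠ wordMat (x ∷ W))                      ∎
  where open ≡-Reasoning

-- The river

value₁₁ : Form → ℤ
value₁₁ f = a f + b f + c f

riverStep-cases : ∀ {f x f′} → riverStep f ≡ just (x , f′) →
  (x ≡ L × value₁₁ f < 0ℤ × f′ ≡ f ∣ᶠ matL) ⊎ (x ≡ R × 0ℤ < value₁₁ f × f′ ≡ f ∣ᶠ matR)
riverStep-cases {f} eq with value₁₁ f <? 0ℤ | 0ℤ <? value₁₁ f
riverStep-cases refl | yes f₁₁<0 | _         = inj₁ (refl , f₁₁<0 , refl)
riverStep-cases refl | no _      | yes 0<f₁₁ = inj₂ (refl , 0<f₁₁ , refl)
riverStep-cases ()   | no _      | no _

riverStep-L : ∀ {f} → value₁₁ f < 0ℤ → riverStep f ≡ just (L , f ∣ᶠ matL)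
riverStep-L {f} f₁₁<0 with value₁₁ f <? 0ℤ
... | yes _ = refl
... | no f₁₁≮0 = ⊥-elim (f₁₁≮0 f₁₁<0)

riverStep-R : ∀ {f} → 0ℤ < value₁₁ f → riverStep f ≡ just (R , f ∣ᶠ matR)
riverStep-R {f} 0<f₁₁ with value₁₁ f <? 0ℤ | 0ℤ <? value₁₁ f
... | yes f₁₁<0 | _        = ⊥-elim (<-asym 0<f₁₁ f₁₁<0)
... | no _      | yes _    = refl
... | no _      | no 0≮f₁₁ = ⊥-elim (0≮f₁₁ 0<f₁₁)

data River : ℕ → Form → List Letter → Form → Set where
  done : ∀ {f} → River 0 f [] f
  step : ∀ {n f x f′ w g} → riverStep f ≡ just (x , f′) → River n f′ w g → River (suc n) f (x ∷ w) g

riverRun⇒River : ∀ n f {w g} → riverRun n f ≡ just (w , g) → River n f w g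
riverRun⇒River zero f refl = done
riverRun⇒River (suc n) f eq with riverStep f in stepEq
riverRun⇒River (suc n) f () | nothing
... | just (x , f′) with riverRun n f′ in runEq
riverRun⇒River (suc n) f () | just (x , f′) | nothing
riverRun⇒River (suc n) f refl | just (x , f′) | just (w , g) = step stepEq (riverRun⇒River n f′ runEq)

River⇒riverRun : ∀ {n f w g} → River n f w g → riverRun n f ≡ just (w , g)
River⇒riverRun done = refl
River⇒riverRun {suc n} {f} (step {f′ = f′} stepEq river) with riverStep f | stepEq
... | just _ | refl with riverRun n f′ | River⇒riverRun river
... | just _ | refl = refl

River-length : ∀ {n f w g} → River n f w g → length w ≡ n
River-length done = refl
River-length (step _ river) = cong suc (River-length river)

River-zero : ∀ {f w g} → River 0 f w g → f ≡ g
River-zero done = refl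

River-deterministic : ∀ {n f w g w′ g′} → River n f w g → River n f w′ g′ → w ≡ w′ × g ≡ g′
River-deterministic done done = refl , refl
River-deterministic (step e river) (step e′ river′) with trans (sym e) e′
... | refl with River-deterministic river river′
... | refl , refl = refl , refl

River-++ : ∀ {m n f w g w′ h} → River m f w g → River n g w′ h → River (m ℕ.+ n) f (w ++ w′) h
River-++ done river′ = river′
River-++ (step e river) river′ = step e (River-++ river river′)

River-splitAt : ∀ m {n f w h} → River (m ℕ.+ n) f w h →
  ∃[ w₁ ] ∃[ w₂ ] ∃[ g ] w ≡ w₁ ++ w₂ × River m f w₁ g × River n g w₂ h
River-splitAt zero river = [] , _ , _ , refl , done , river
River-splitAt (suc m) (step e river) with River-splitAt m river
... | w₁ , w₂ , g , refl , river₁ , river₂ = _ ∷ w₁ , w₂ , g , refl , step e river₁ , river₂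

River-split-++ : ∀ U {V n f h} → River n f (U ++ V) h →
  ∃[ g ] River (length U) f U g × River (length V) g V h
River-split-++ [] river rewrite River-length river = _ , done , river
River-split-++ (x ∷ U) (step e river) with River-split-++ U river
... | g , river₁ , river₂ = g , step e river₁ , river₂

River-∣ᶠ : ∀ {n f w g} → River n f w g → f ∣ᶠ wordMat w ≡ g
River-∣ᶠ {f = f} done = ∣ᶠ-I₂ f
River-∣ᶠ {f = f} (step {w = w} e river) with riverStep-cases e
... | inj₁ (refl , _ , refl) = trans (∣ᶠ-wordMat-∷ f L w) (River-∣ᶠ river)
... | inj₂ (refl , _ , refl) = trans (∣ᶠ-wordMat-∷ f R w) (River-∣ᶠ river)

value₁₁-negDual : ∀ f → value₁₁ (negDual f) ≡ - value₁₁ f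
value₁₁-negDual [ a , b , c ] = identity a b c
  where
  identity : ∀ a b c → - c + - b + - a ≡ - (a + b + c)
  identity = solve-∀

riverStep-negDual : ∀ {f x f′} → riverStep f ≡ just (x , f′) → riverStep (negDual f) ≡ just (swap x , negDual f′)
riverStep-negDual {f} e with riverStep-cases e
... | inj₁ (refl , f₁₁<0 , refl) =
  trans (riverStep-R (subst (0ℤ <_) (sym (value₁₁-negDual f)) (neg-mono-< f₁₁<0)))
        (cong (λ g → just (R , g)) (negDual-∣ᶠ-matR f))
... | inj₂ (refl , 0<f₁₁ , refl) =
  trans (riverStep-L (subst (_< 0ℤ) (sym (value₁₁-negDual f)) (neg-mono-< 0<f₁₁)))
        (cong (λ g → just (L , g)) (negDual-∣ᶠ-matL f))

River-negDual : ∀ {n f w g} → River n f w g → River n (negDual f) (bar w) (negDual g)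
River-negDual done = done
River-negDual (step e river) = step (riverStep-negDual e) (River-negDual river)

RiverForm : Form → Set
RiverForm f = 0ℤ < a f × c f < 0ℤ × ¬ IsSquare (disc f)

RiverForm-negDual : ∀ {f} → RiverForm f → RiverForm (negDual f)
RiverForm-negDual {f} (0<a , c<0 , nonSquare) =
  neg-mono-< c<0 , neg-mono-< 0<a , subst (λ d → ¬ IsSquare d) (sym (disc-negDual f)) nonSquare

value₁₁≢0 : ∀ f → ¬ IsSquare (disc f) → value₁₁ f ≢ 0ℤ
value₁₁≢0 [ a , b , c ] nonSquare f₁₁≡0 = nonSquare (k , (begin
  b * b - (+ 4) * a * c                ≡⟨ completeSquare a b c ⟩
  k * k - (+ 4) * a * (a + b + c)      ≡⟨ cong (λ v → k * k - (+ 4) * a * v) f₁₁≡0 ⟩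
  k * k - (+ 4) * a * 0ℤ               ≡⟨ cong (λ v → k * k - v) (*-zeroʳ ((+ 4) * a)) ⟩
  k * k - 0ℤ                           ≡⟨ +-identityʳ (k * k) ⟩
  k * k                                ∎))
  where
  open ≡-Reasoning
  k = (+ 2) * a + b
  completeSquare : ∀ a b c → b * b - (+ 4) * a * c ≡ ((+ 2) * a + b) * ((+ 2) * a + b) - (+ 4) * a * (a + b + c)
  completeSquare = solve-∀

RiverForm-matL : ∀ {f} → RiverForm f → value₁₁ f < 0ℤ → RiverForm (f ∣ᶠ matL)
RiverForm-matL {f} (0<a , _ , nonSquare) f₁₁<0 =
  subst (0ℤ <_) (sym (cong Form.a (∣ᶠ-matL f))) 0<a ,
  subst (_< 0ℤ) (sym (cong Form.c (∣ᶠ-matL f))) f₁₁<0 ,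
  subst (λ d → ¬ IsSquare d) (sym (disc-∣ᶠ-SL f matL refl)) nonSquare

RiverForm-matR : ∀ {f} → RiverForm f → 0ℤ < value₁₁ f → RiverForm (f ∣ᶠ matR)
RiverForm-matR {f} (_ , c<0 , nonSquare) 0<f₁₁ =
  subst (0ℤ <_) (sym (cong Form.a (∣ᶠ-matR f))) 0<f₁₁ ,
  subst (_< 0ℤ) (sym (cong Form.c (∣ᶠ-matR f))) c<0 ,
  subst (λ d → ¬ IsSquare d) (sym (disc-∣ᶠ-SL f matR refl)) nonSquare

RiverForm-River : ∀ {n f w g} → RiverForm f → River n f w g → RiverForm g
RiverForm-River rf done = rf
RiverForm-River rf (step e river) with riverStep-cases e
... | inj₁ (refl , f₁₁<0 , refl) = RiverForm-River (RiverForm-matL rf f₁₁<0) river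
... | inj₂ (refl , 0<f₁₁ , refl) = RiverForm-River (RiverForm-matR rf 0<f₁₁) river

NegativeRegion : Form → Set
NegativeRegion f = a f < 0ℤ × b f ≤ 0ℤ × c f < 0ℤ

NegativeRegion-matL : ∀ {f} → NegativeRegion f → NegativeRegion (f ∣ᶠ matL)
NegativeRegion-matL {f} (a<0 , b≤0 , c<0) = subst NegativeRegion (sym (∣ᶠ-matL f))
  (a<0 , <⇒≤ (+-mono-≤-< b≤0 (*-monoˡ-<-pos (+ 2) a<0)) , +-mono-< (+-mono-<-≤ a<0 b≤0) c<0)

NegativeRegion-matR : ∀ {f} → NegativeRegion f → NegativeRegion (f ∣ᶠ matR)
NegativeRegion-matR {f} (a<0 , b≤0 , c<0) = subst NegativeRegion (sym (∣ᶠ-matR f))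
  (+-mono-< (+-mono-<-≤ a<0 b≤0) c<0 , <⇒≤ (+-mono-≤-< b≤0 (*-monoˡ-<-pos (+ 2) c<0)) , c<0)

NegativeRegion-wordMat : ∀ {f} W → NegativeRegion f → NegativeRegion (f ∣ᶠ wordMat W)
NegativeRegion-wordMat {f} [] neg = subst NegativeRegion (sym (∣ᶠ-I₂ f)) neg
NegativeRegion-wordMat {f} (L ∷ W) neg =
  subst NegativeRegion (sym (∣ᶠ-wordMat-∷ f L W)) (NegativeRegion-wordMat W (NegativeRegion-matL neg))
NegativeRegion-wordMat {f} (R ∷ W) neg =
  subst NegativeRegion (sym (∣ᶠ-wordMat-∷ f R W)) (NegativeRegion-wordMat W (NegativeRegion-matR neg))

wrong-turn-R : ∀ {f} W → RiverForm f → value₁₁ f < 0ℤ → ¬ RiverForm (f ∣ᶠ wordMat (R ∷ W))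
wrong-turn-R {f} W (0<a , c<0 , _) f₁₁<0 (0<a′ , _ , _) =
  <-asym 0<a′ (subst NegativeRegion (sym (∣ᶠ-wordMat-∷ f R W)) (NegativeRegion-wordMat W negR) .proj₁)
  where
  negR : NegativeRegion (f ∣ᶠ matR)
  negR = subst NegativeRegion (sym (∣ᶠ-matR f))
    (f₁₁<0 , <⇒≤ (subst (_< 0ℤ) (sym (shift (a f) (b f) (c f))) (+-mono-< (+-mono-< f₁₁<0 c<0) (neg-mono-< 0<a))) , c<0)
    where
    shift : ∀ a b c → b + (+ 2) * c ≡ a + b + c + c + - a
    shift = solve-∀

wrong-turn-L : ∀ {f} W → RiverForm f → 0ℤ < value₁₁ f → ¬ RiverForm (f ∣ᶠ wordMat (L ∷ W))
wrong-turn-L {f} W rf 0<f₁₁ rg =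
  wrong-turn-R {negDual f} (bar W) (RiverForm-negDual {f} rf)
    (subst (_< 0ℤ) (sym (value₁₁-negDual f)) (neg-mono-< 0<f₁₁))
    (subst RiverForm (sym (negDual-∣ᶠ-wordMat f (L ∷ W))) (RiverForm-negDual {f ∣ᶠ wordMat (L ∷ W)} rg))

River-of-∣ᶠ : ∀ W {f g} → RiverForm f → RiverForm g → f ∣ᶠ wordMat W ≡ g → River (length W) f W g
River-of-∣ᶠ [] {f} _ _ e = subst (River 0 f []) (trans (sym (∣ᶠ-I₂ f)) e) done
River-of-∣ᶠ (x ∷ W) {f} rf rg e with <-cmp (value₁₁ f) 0ℤ | x
... | tri< f₁₁<0 _ _ | L =
  step (riverStep-L f₁₁<0) (River-of-∣ᶠ W (RiverForm-matL rf f₁₁<0) rg (trans (sym (∣ᶠ-wordMat-∷ f L W)) e))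
... | tri< f₁₁<0 _ _ | R = ⊥-elim (wrong-turn-R W rf f₁₁<0 (subst RiverForm (sym e) rg))
... | tri≈ _ f₁₁≡0 _ | _ = ⊥-elim (value₁₁≢0 f (rf .proj₂ .proj₂) f₁₁≡0)
... | tri> _ _ 0<f₁₁ | R =
  step (riverStep-R 0<f₁₁) (River-of-∣ᶠ W (RiverForm-matR rf 0<f₁₁) rg (trans (sym (∣ᶠ-wordMat-∷ f R W)) e))
... | tri> _ _ 0<f₁₁ | L = ⊥-elim (wrong-turn-L W rf 0<f₁₁ (subst RiverForm (sym e) rg))

-- Periodicity of the river

≢negDual : ∀ f → ¬ IsSquare (disc f) → f ≢ negDual f
≢negDual [ a , b , c ] nonSquare f≡f′ = nonSquare ((+ 2) * a , (begin
  b * b - (+ 4) * a * c                                   ≡⟨ identity a b c ⟩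
  b * b + ((+ 2) * a) * ((+ 2) * a) - (+ 4) * a * (a + c) ≡⟨ cong₂ (λ u v → u * u + ((+ 2) * a) * ((+ 2) * a) - (+ 4) * a * v) b≡0 a+c≡0 ⟩
  0ℤ * 0ℤ + ((+ 2) * a) * ((+ 2) * a) - (+ 4) * a * 0ℤ   ≡⟨ identity₀ a ⟩
  ((+ 2) * a) * ((+ 2) * a)                               ∎))
  where
  open ≡-Reasoning
  identity : ∀ a b c → b * b - (+ 4) * a * c ≡ b * b + ((+ 2) * a) * ((+ 2) * a) - (+ 4) * a * (a + c)
  identity = solve-∀
  identity₀ : ∀ a → 0ℤ * 0ℤ + ((+ 2) * a) * ((+ 2) * a) - (+ 4) * a * 0ℤ ≡ ((+ 2) * a) * ((+ 2) * a)
  identity₀ = solve-∀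
  two* : ∀ b → (+ 2) * b ≡ b + b
  two* = solve-∀
  b≡0 : b ≡ 0ℤ
  b≡0 = 2*i≡0⇒i≡0 (trans (two* b) (i≡-j⇒i+j≡0 (cong Form.b f≡f′)))
  a+c≡0 : a + c ≡ 0ℤ
  a+c≡0 = i≡-j⇒i+j≡0 (cong Form.a f≡f′)

record RiverPeriod (q : Form) (n : ℕ) (w : List Letter) : Set where
  field
    nonEmpty : 1 ℕ.≤ n
    loop     : River n q w q
    minimal  : ∀ {j w′} → 1 ℕ.≤ j → j ℕ.< n → ¬ River j q w′ q

RiverWord⇒RiverPeriod : ∀ {q w} → RiverWord q w → ∃[ n ] RiverPeriod q n w
RiverWord⇒RiverPeriod {q} (n , 1≤n , run , noEarlierReturn) = n , record
  { nonEmpty = 1≤n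
  ; loop     = riverRun⇒River n q run
  ; minimal  = λ {j} {w′} 1≤j j<n river → noEarlierReturn j w′ 1≤j j<n (River⇒riverRun river)
  }

module _ {q n w} (P : RiverPeriod q n w) where
  open RiverPeriod P

  River-reduce : ∀ {m W g} → Acc ℕ._<_ m → River m q W g → ∃[ m′ ] ∃[ W′ ] m′ ℕ.< n × River m′ q W′ g
  River-reduce {m} {W} (acc rec) river with m ℕ.<? n
  ... | yes m<n = m , W , m<n , river
  ... | no m≮n with ℕₚ.m≤n⇒∃[o]m+o≡n (ℕₚ.≮⇒≥ m≮n)
  ... | k , refl with River-splitAt n river
  ... | _ , _ , _ , refl , river₁ , river₂ with River-deterministic loop river₁
  ... | refl , refl = River-reduce (rec (ℕₚ.m<n+m k nonEmpty)) river₂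

  River-double : ∀ {m W} → River m q W (negDual q) → River (m ℕ.+ m) q (W ++ bar W) q
  River-double river = River-++ river (subst (River _ (negDual q) _) (negDual-involutive q) (River-negDual river))

  -- Reaching -q* at time m < n forces the period to be 2m: returning to q at 2m < n
  -- or at 2m - n would contradict minimality.
  half-period : ∀ {m W} → 1 ℕ.≤ m → m ℕ.< n → River m q W (negDual q) → m ℕ.+ m ≡ n × w ≡ W ++ bar W
  half-period {m} {W} 1≤m m<n river with ℕₚ.<-cmp (m ℕ.+ m) n
  ... | tri< 2m<n _ _ = ⊥-elim (minimal (ℕₚ.≤-trans 1≤m (ℕₚ.m≤m+n m m)) 2m<n (River-double river))
  ... | tri≈ _ 2m≡n _ = 2m≡n , River-deterministic loop (subst (λ j → River j q (W ++ bar W) q) 2m≡n (River-double river)) .proj₁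
  ... | tri> _ _ n<2m with ℕₚ.m≤n⇒∃[o]m+o≡n (ℕₚ.<⇒≤ n<2m)
  ...   | k , n+k≡2m with River-splitAt n (subst (λ j → River j q (W ++ bar W) q) (sym n+k≡2m) (River-double river))
  ...     | _ , _ , _ , _ , river₁ , river₂ with River-deterministic loop river₁
  ...       | refl , refl = ⊥-elim (minimal 1≤k k<n river₂)
    where
    1≤k : 1 ℕ.≤ k
    1≤k = ℕₚ.+-cancelˡ-< n 0 k (subst₂ ℕ._<_ (sym (ℕₚ.+-identityʳ n)) (sym n+k≡2m) n<2m)
    k<n : k ℕ.< n
    k<n = ℕₚ.+-cancelˡ-< n k n (subst (ℕ._< n ℕ.+ n) (sym n+k≡2m) (ℕₚ.+-mono-< m<n m<n))

  River-length-pos : ∀ {m W} → q ≢ negDual q → River m q W (negDual q) → 1 ℕ.≤ m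
  River-length-pos {zero} q≢q′ river = ⊥-elim (q≢q′ (River-zero river))
  River-length-pos {suc _} _ _ = s≤s z≤n

  reaches-negDual⇒split : ∀ {m W} → q ≢ negDual q → River m q W (negDual q) → ∃[ X ] w ≡ X ++ bar X
  reaches-negDual⇒split q≢q′ river with River-reduce (<-wellFounded _) river
  ... | _ , W′ , m′<n , river′ = W′ , half-period (River-length-pos q≢q′ river′) m′<n river′ .proj₂

  split-length : ∀ X → w ≡ X ++ bar X → length X ℕ.+ length X ≡ n
  split-length X w≡XX̄ = begin
    length X ℕ.+ length X          ≡⟨ cong (length X ℕ.+_) (sym (Listₚ.length-map swap X)) ⟩
    length X ℕ.+ length (bar X)    ≡⟨ sym (Listₚ.length-++ X) ⟩
    length (X ++ bar X)            ≡⟨ cong length (sym w≡XX̄) ⟩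
    length w                       ≡⟨ River-length loop ⟩
    n                              ∎
    where open ≡-Reasoning

  half-length≤ : ∀ {m W} X → q ≢ negDual q → w ≡ X ++ bar X → River m q W (negDual q) → length X ℕ.≤ m
  half-length≤ {m} X q≢q′ w≡XX̄ river with m ℕ.<? n
  ... | no m≮n = ℕₚ.≤-trans (subst (length X ℕ.≤_) (split-length X w≡XX̄) (ℕₚ.m≤m+n _ _)) (ℕₚ.≮⇒≥ m≮n)
  ... | yes m<n = ℕₚ.≮⇒≥ λ m<|X| →
    ℕₚ.<-irrefl (trans (half-period (River-length-pos q≢q′ river) m<n river .proj₁) (sym (split-length X w≡XX̄)))
                (ℕₚ.+-mono-< m<|X| m<|X|)

-- Automorphs and the Pell equation

AutomorphRelations : Form → Mat → Set
AutomorphRelations f M = b f * γ M ≡ a f * (δ M - α M) × a f * β M + c f * γ M ≡ 0ℤ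

-- 2 (b r - a (s - p)) and 2 (a q + c r) are explicit combinations of the entries of q|M ∓ q and of det M ∓ 1.
automorph-relations : ∀ f M → f ∣ᶠ M ≡ f → det M ≡ 1ℤ → AutomorphRelations f M
automorph-relations [ a , b , c ] (mat p q r s) fixed det≡1 =
  i-j≡0⇒i≡j _ _ (2*i≡0⇒i≡0 (trans (relation₁ a b c p q r s) (combination≡0 ((+ 2) * s) (- r) (- ((+ 2) * a * p + b * r)) e₁ e₂ e₃))) ,
  2*i≡0⇒i≡0 (trans (relation₂ a b c p q r s) (combination≡0 (- ((+ 2) * q)) p (- (b * p + (+ 2) * c * r)) e₁ e₂ e₃))
  where
  e₁ = i≡j⇒i-j≡0 (cong Form.a fixed)
  e₂ = i≡j⇒i-j≡0 (cong Form.b fixed)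
  e₃ = i≡j⇒i-j≡0 det≡1
  relation₁ : ∀ a b c p q r s → (+ 2) * (b * r - a * (s - p)) ≡
    (+ 2) * s * (a * p * p + b * p * r + c * r * r - a)
    + (- r) * ((+ 2) * a * p * q + b * (p * s + q * r) + (+ 2) * c * r * s - b)
    + (- ((+ 2) * a * p + b * r)) * (p * s - q * r - 1ℤ)
  relation₁ = solve-∀
  relation₂ : ∀ a b c p q r s → (+ 2) * (a * q + c * r) ≡
    (- ((+ 2) * q)) * (a * p * p + b * p * r + c * r * r - a)
    + p * ((+ 2) * a * p * q + b * (p * s + q * r) + (+ 2) * c * r * s - b)
    + (- (b * p + (+ 2) * c * r)) * (p * s - q * r - 1ℤ)
  relation₂ = solve-∀

antiautomorph-relations : ∀ f M → f ∣ᶠ M ≡ negF f → det M ≡ - 1ℤ → AutomorphRelations f M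
antiautomorph-relations [ a , b , c ] (mat p q r s) negated det≡-1 =
  i-j≡0⇒i≡j _ _ (2*i≡0⇒i≡0 (trans (relation₁ a b c p q r s) (combination≡0 (- ((+ 2) * s)) r ((+ 2) * a * p + b * r) e₁ e₂ e₃))) ,
  2*i≡0⇒i≡0 (trans (relation₂ a b c p q r s) (combination≡0 ((+ 2) * q) (- p) (b * p + (+ 2) * c * r) e₁ e₂ e₃))
  where
  e₁ = i≡-j⇒i+j≡0 (cong Form.a negated)
  e₂ = i≡-j⇒i+j≡0 (cong Form.b negated)
  e₃ = i≡-j⇒i+j≡0 det≡-1
  relation₁ : ∀ a b c p q r s → (+ 2) * (b * r - a * (s - p)) ≡
    (- ((+ 2) * s)) * (a * p * p + b * p * r + c * r * r + a)
    + r * ((+ 2) * a * p * q + b * (p * s + q * r) + (+ 2) * c * r * s + b)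
    + ((+ 2) * a * p + b * r) * (p * s - q * r + 1ℤ)
  relation₁ = solve-∀
  relation₂ : ∀ a b c p q r s → (+ 2) * (a * q + c * r) ≡
    (+ 2) * q * (a * p * p + b * p * r + c * r * r + a)
    + (- p) * ((+ 2) * a * p * q + b * (p * s + q * r) + (+ 2) * c * r * s + b)
    + (b * p + (+ 2) * c * r) * (p * s - q * r + 1ℤ)
  relation₂ = solve-∀

-- With γ M ≠ 0 the relations fix the ratios a : b : c, and the discriminant then fixes the scale.
automorph-determines-form : ∀ f g M → f ∣ᶠ M ≡ f → g ∣ᶠ M ≡ g → det M ≡ 1ℤ → 0ℤ < γ M →
  disc f ≡ disc g → 0ℤ < disc f → 0ℤ < a f → 0ℤ < a g → f ≡ g
automorph-determines-form [ a , b , c ] [ a′ , b′ , c′ ] M fixed fixed′ det≡1 0<r disc≡ 0<D 0<a 0<a′ =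
  Form-≡ a≡a′ (sym (*-cancelˡ-pos 0<a (i-j≡0⇒i≡j _ _ (subst (λ x → a * b′ - x * b ≡ 0ℤ) (sym a≡a′) ab′≡a′b))))
              (sym (*-cancelˡ-pos 0<a (i-j≡0⇒i≡j _ _ (subst (λ x → a * c′ - x * c ≡ 0ℤ) (sym a≡a′) ac′≡a′c))))
  where
  rel = automorph-relations [ a , b , c ] M fixed det≡1
  rel′ = automorph-relations [ a′ , b′ , c′ ] M fixed′ det≡1
  p = α M
  q = β M
  r = γ M
  s = δ M
  D = b * b - (+ 4) * a * c
  ab′≡a′b : a * b′ - a′ * b ≡ 0ℤ
  ab′≡a′b = pos*j≡0⇒j≡0 0<r (trans (identity a b a′ b′ p r s)
    (combination₂≡0 a (- a′) (i≡j⇒i-j≡0 (rel′ .proj₁)) (i≡j⇒i-j≡0 (rel .proj₁))))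
    where
    identity : ∀ a b a′ b′ p r s → r * (a * b′ - a′ * b) ≡ a * (b′ * r - a′ * (s - p)) + (- a′) * (b * r - a * (s - p))
    identity = solve-∀
  ac′≡a′c : a * c′ - a′ * c ≡ 0ℤ
  ac′≡a′c = pos*j≡0⇒j≡0 0<r (trans (identity a c a′ c′ q r) (combination₂≡0 a (- a′) (rel′ .proj₂) (rel .proj₂)))
    where
    identity : ∀ a c a′ c′ q r → r * (a * c′ - a′ * c) ≡ a * (a′ * q + c′ * r) + (- a′) * (a * q + c * r)
    identity = solve-∀
  a≡a′ : a ≡ a′
  a≡a′ = i-j≡0⇒i≡j a a′ (pos*j≡0⇒j≡0 (+-mono-< 0<a 0<a′) (pos*j≡0⇒j≡0 0<D (begin
    D * ((a + a′) * (a - a′))                                ≡⟨ identity₁ a a′ D ⟩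
    a * a * D - a′ * a′ * D                                  ≡⟨ cong (λ d → a * a * d - a′ * a′ * D) disc≡ ⟩
    a * a * (b′ * b′ - (+ 4) * a′ * c′) - a′ * a′ * D        ≡⟨ identity₂ a b c a′ b′ c′ ⟩
    (a * b′ + a′ * b) * (a * b′ - a′ * b) + (- ((+ 4) * a * a′)) * (a * c′ - a′ * c)
                                                             ≡⟨ combination₂≡0 (a * b′ + a′ * b) (- ((+ 4) * a * a′)) ab′≡a′b ac′≡a′c ⟩
    0ℤ                                                       ∎)))
    where
    open ≡-Reasoning
    identity₁ : ∀ a a′ D → D * ((a + a′) * (a - a′)) ≡ a * a * D - a′ * a′ * D
    identity₁ = solve-∀
    identity₂ : ∀ a b c a′ b′ c′ → a * a * (b′ * b′ - (+ 4) * a′ * c′) - a′ * a′ * (b * b - (+ 4) * a * c)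
      ≡ (a * b′ + a′ * b) * (a * b′ - a′ * b) + (- ((+ 4) * a * a′)) * (a * c′ - a′ * c)
    identity₂ = solve-∀

gcd-scaling : ∀ A B C x y z → ℕGCD.gcd (ℕGCD.gcd A B) C ≡ 1 → A ℕ.* y ≡ B ℕ.* x → A ℕ.* z ≡ C ℕ.* x →
  A ℕ.* ℕGCD.gcd (ℕGCD.gcd x y) z ≡ x
gcd-scaling A B C x y z coprime Ay≡Bx Az≡Cx = begin
  A ℕ.* G (G x y) z                                 ≡⟨ ℕGCD.c*gcd[m,n]≡gcd[cm,cn] A _ z ⟩
  G (A ℕ.* G x y) (A ℕ.* z)                         ≡⟨ cong (λ v → G v (A ℕ.* z)) (ℕGCD.c*gcd[m,n]≡gcd[cm,cn] A x y) ⟩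
  G (G (A ℕ.* x) (A ℕ.* y)) (A ℕ.* z)               ≡⟨ cong₂ (λ u v → G (G u (A ℕ.* y)) v) (ℕₚ.*-comm A x) Az≡Cx ⟩
  G (G (x ℕ.* A) (A ℕ.* y)) (C ℕ.* x)               ≡⟨ cong₂ (λ u v → G (G (x ℕ.* A) u) v) (trans Ay≡Bx (ℕₚ.*-comm B x)) (ℕₚ.*-comm C x) ⟩
  G (G (x ℕ.* A) (x ℕ.* B)) (x ℕ.* C)               ≡⟨ cong (λ v → G v (x ℕ.* C)) (sym (ℕGCD.c*gcd[m,n]≡gcd[cm,cn] x A B)) ⟩
  G (x ℕ.* G A B) (x ℕ.* C)                         ≡⟨ sym (ℕGCD.c*gcd[m,n]≡gcd[cm,cn] x _ C) ⟩
  x ℕ.* G (G A B) C                                 ≡⟨ cong (x ℕ.*_) coprime ⟩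
  x ℕ.* 1                                           ≡⟨ ℕₚ.*-identityʳ x ⟩
  x                                                 ∎
  where
  open ≡-Reasoning
  G = ℕGCD.gcd

PellSol-neg : ∀ {D t u} → PellSol D t (- u) → PellSol D t u
PellSol-neg {D} {t} {u} = subst (λ v → t * t - v ≡ - (+ 4)) (identity D u)
  where
  identity : ∀ D u → D * (- u) * (- u) ≡ D * u * u
  identity = solve-∀

relations-Pell : ∀ {a b c p q r s} u → 0ℤ < a → b * r ≡ a * (s - p) → a * q + c * r ≡ 0ℤ →
  p * s - q * r ≡ - 1ℤ → r ≡ a * u → PellSol (b * b - (+ 4) * a * c) (p + s) u
relations-Pell {a} {b} {c} {p} {q} {r} {s} u 0<a br≡a[s-p] aq+cr≡0 det≡-1 r≡au =
  i-j≡0⇒i≡j _ _ (trans (identity a b c p q r s u)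
    (combination₄≡0 (i≡j⇒i-j≡0 s-p≡bu) (i≡-j⇒i+j≡0 det≡-1) q+cu≡0 (i≡j⇒i-j≡0 r≡au)))
  where
  identity : ∀ a b c p q r s u → (p + s) * (p + s) - (b * b - (+ 4) * a * c) * u * u - (- (+ 4)) ≡
    (s - p + b * u) * ((s - p) - b * u) + (+ 4) * (p * s - q * r + 1ℤ) + ((+ 4) * r) * (q + c * u)
    + (- ((+ 4) * c * u)) * (r - a * u)
  identity = solve-∀
  combination₄≡0 : ∀ {e₁ e₂ e₃ e₄} → e₁ ≡ 0ℤ → e₂ ≡ 0ℤ → e₃ ≡ 0ℤ → e₄ ≡ 0ℤ →
    (s - p + b * u) * e₁ + (+ 4) * e₂ + ((+ 4) * r) * e₃ + (- ((+ 4) * c * u)) * e₄ ≡ 0ℤ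
  combination₄≡0 refl refl refl refl = zero₄ (s - p + b * u) ((+ 4) * r) (- ((+ 4) * c * u))
    where
    zero₄ : ∀ x y z → x * 0ℤ + (+ 4) * 0ℤ + y * 0ℤ + z * 0ℤ ≡ 0ℤ
    zero₄ = solve-∀
  s-p≡bu : s - p ≡ b * u
  s-p≡bu = *-cancelˡ-pos 0<a (trans (sym br≡a[s-p]) (trans (cong (b *_) r≡au) (swap-factors b a u)))
    where
    swap-factors : ∀ b a u → b * (a * u) ≡ a * (b * u)
    swap-factors = solve-∀
  q+cu≡0 : q + c * u ≡ 0ℤ
  q+cu≡0 = pos*j≡0⇒j≡0 0<a (trans (distrib a q c u) (trans (cong (λ v → a * q + c * v) (sym r≡au)) aq+cr≡0))
    where
    distrib : ∀ a q c u → a * (q + c * u) ≡ a * q + c * (a * u)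
    distrib = solve-∀

antiautomorph-Pell : ∀ f M → Primitive f → 0ℤ < a f → f ∣ᶠ M ≡ negF f → det M ≡ - 1ℤ →
  let u = gcd (gcd (γ M) (δ M - α M)) (β M) in
  (γ M ≡ a f * u ⊎ γ M ≡ - (a f * u)) × PellSol (disc f) (α M + δ M) u
antiautomorph-Pell [ a , b , c ] (mat p q r s) coprime 0<a negated det≡-1 = r≡±au , pell r≡±au
  where
  rel = antiautomorph-relations [ a , b , c ] (mat p q r s) negated det≡-1
  u = gcd (gcd r (s - p)) q
  -- a (r, s - p, q) = r (a, b, -c) and gcd (a, b, c) = 1
  |a|u≡|r| : ∣ a ∣ ℕ.* ∣ u ∣ ≡ ∣ r ∣
  |a|u≡|r| = gcd-scaling (∣ a ∣) (∣ b ∣) (∣ c ∣) (∣ r ∣) (∣ s - p ∣) (∣ q ∣) (+-injective coprime)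
    (trans (sym (abs-* a (s - p))) (trans (cong ∣_∣ (sym (rel .proj₁))) (abs-* b r)))
    (trans (sym (abs-* a q)) (trans (sym (∣-i∣≡∣i∣ (a * q)))
      (trans (cong ∣_∣ (sym (i+j≡0⇒j≡-i {a * q} {c * r} (rel .proj₂)))) (abs-* c r))))
  r≡±au : r ≡ a * u ⊎ r ≡ - (a * u)
  r≡±au = ∣i∣≡∣j∣⇒i≡±j (trans (sym |a|u≡|r|) (sym (abs-* a u)))
  pell : r ≡ a * u ⊎ r ≡ - (a * u) → PellSol (b * b - (+ 4) * a * c) (p + s) u
  pell (inj₁ r≡au) = relations-Pell {a} {b} {c} {p} {q} {r} {s} u 0<a (rel .proj₁) (rel .proj₂) det≡-1 r≡au
  pell (inj₂ r≡-au) = PellSol-neg {b * b - (+ 4) * a * c} {p + s} {u}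
    (relations-Pell {a} {b} {c} {p} {q} {r} {s} (- u) 0<a (rel .proj₁) (rel .proj₂) det≡-1 (trans r≡-au (neg-distribʳ-* a u)))

PellSol-abs : ∀ {D t u} → PellSol D t u → PellSol D (+ ∣ t ∣) (+ ∣ u ∣)
PellSol-abs {D} {t} {u} pell = trans (cong₂ _-_ (abs-square t) (begin
  D * (+ ∣ u ∣) * (+ ∣ u ∣)       ≡⟨ *-assoc D (+ ∣ u ∣) (+ ∣ u ∣) ⟩
  D * ((+ ∣ u ∣) * (+ ∣ u ∣))     ≡⟨ cong (D *_) (abs-square u) ⟩
  D * (u * u)                     ≡⟨ sym (*-assoc D u u) ⟩
  D * u * u                       ∎)) pell
  where
  open ≡-Reasoning
  abs-square : ∀ i → (+ ∣ i ∣) * (+ ∣ i ∣) ≡ i * i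
  abs-square (+ n) = refl
  abs-square -[1+ n ] = refl

¬PellSol-u≡0 : ∀ {D t} → ¬ PellSol D t 0ℤ
¬PellSol-u≡0 {D} {t} pell = <-irrefl refl (≤-<-trans (square-nonNeg t) (subst (_< 0ℤ) (sym t²≡-4) -<+))
  where
  t²≡-4 : t * t ≡ - (+ 4)
  t²≡-4 = trans (sym (identity t D)) pell
    where
    identity : ∀ t D → t * t - D * 0ℤ * 0ℤ ≡ t * t
    identity = solve-∀
  square-nonNeg : ∀ i → 0ℤ ≤ i * i
  square-nonNeg (+ n) = subst (0ℤ ≤_) (pos-* n n) (+≤+ z≤n)
  square-nonNeg -[1+ n ] = +≤+ z≤n

∼negDual⇒Pell : ∀ q → Primitive q → 0ℤ < a q → q ∼ negDual q → ∃[ t ] ∃[ u ] PellSol (disc q) t u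
∼negDual⇒Pell q coprime 0<a (M , det≡1 , q≡q′∣M) = α N + δ N , gcd (gcd (γ N) (δ N - α N)) (β N) ,
  antiautomorph-Pell q N coprime 0<a (trans (∣ᶠ-colSwap q (adj M)) (cong _* q∣adjM≡q′))
    (trans (det-colSwap (adj M)) (cong -_ (trans (det-adj M) det≡1))) .proj₂
  where
  open ≡-Reasoning
  N = colSwap (adj M)
  q∣adjM≡q′ : q ∣ᶠ adj M ≡ negDual q
  q∣adjM≡q′ = begin
    q ∣ᶠ adj M                        ≡⟨ cong (_∣ᶠ adj M) q≡q′∣M ⟩
    (negDual q ∣ᶠ M) ∣ᶠ adj M          ≡⟨ ∣ᶠ-· (negDual q) M (adj M) ⟩
    negDual q ∣ᶠ (M · adj M)           ≡⟨ cong (negDual q ∣ᶠ_) (·-adj M det≡1) ⟩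
    negDual q ∣ᶠ I₂                    ≡⟨ ∣ᶠ-I₂ (negDual q) ⟩
    negDual q                         ∎

-- Products of L and R

WordBounds : Mat → Set
WordBounds M = 1ℤ ≤ α M × 0ℤ ≤ β M × 0ℤ ≤ γ M × 1ℤ ≤ δ M

wordMat-bounds : ∀ W → WordBounds (wordMat W)
wordMat-bounds [] = ≤-refl , ≤-refl , ≤-refl , ≤-refl
wordMat-bounds (L ∷ W) with wordMat-bounds W
... | 1≤α , 0≤β , 0≤γ , 1≤δ = subst WordBounds (sym (matL-· (wordMat W)))
  (i≤j⇒i≤k+j _ {{nonNegative 0≤γ}} 1≤α , +-mono-≤ (1≤i⇒0≤i 1≤δ) 0≤β , 0≤γ , 1≤δ)
wordMat-bounds (R ∷ W) with wordMat-bounds W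
... | 1≤α , 0≤β , 0≤γ , 1≤δ = subst WordBounds (sym (matR-· (wordMat W)))
  (1≤α , 0≤β , +-mono-≤ (1≤i⇒0≤i 1≤α) 0≤γ , i≤j⇒i≤k+j _ {{nonNegative 0≤β}} 1≤δ)

1≤γ-wordMat-R : ∀ U V → 1ℤ ≤ γ (wordMat (U ++ R ∷ V))
1≤γ-wordMat-R [] V with wordMat-bounds V
... | 1≤α , _ , 0≤γ , _ = subst (λ M → 1ℤ ≤ γ M) (sym (matR-· (wordMat V)))
  (≤-trans 1≤α (i≤i+j _ _ {{nonNegative 0≤γ}}))
1≤γ-wordMat-R (L ∷ U) V = subst (λ M → 1ℤ ≤ γ M) (sym (matL-· (wordMat (U ++ R ∷ V)))) (1≤γ-wordMat-R U V)
1≤γ-wordMat-R (R ∷ U) V with wordMat-bounds (U ++ R ∷ V)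
... | 1≤α , _ , _ , _ = subst (λ M → 1ℤ ≤ γ M) (sym (matR-· (wordMat (U ++ R ∷ V))))
  (i≤j⇒i≤k+j _ {{nonNegative (1≤i⇒0≤i 1≤α)}} (1≤γ-wordMat-R U V))

1≤β+γ-wordMat : ∀ x W → 1ℤ ≤ β (wordMat (x ∷ W)) + γ (wordMat (x ∷ W))
1≤β+γ-wordMat L W with wordMat-bounds W
... | _ , 0≤β , 0≤γ , 1≤δ = subst (λ M → 1ℤ ≤ β M + γ M) (sym (matL-· (wordMat W)))
  (≤-trans 1≤δ (≤-trans (i≤i+j _ _ {{nonNegative 0≤β}}) (i≤i+j _ _ {{nonNegative 0≤γ}})))
1≤β+γ-wordMat R W with wordMat-bounds W
... | 1≤α , 0≤β , 0≤γ , _ = subst (λ M → 1ℤ ≤ β M + γ M) (sym (matR-· (wordMat W)))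
  (≤-trans 1≤α (≤-trans (i≤i+j _ _ {{nonNegative 0≤γ}}) (i≤j+i _ _ {{nonNegative 0≤β}})))

1≤γ-wordMat-bar-++ : ∀ x X → 1ℤ ≤ γ (wordMat (bar (x ∷ X) ++ x ∷ X))
1≤γ-wordMat-bar-++ L X = 1≤γ-wordMat-R [] (bar X ++ L ∷ X)
1≤γ-wordMat-bar-++ R X = 1≤γ-wordMat-R (L ∷ bar X) X

x≤uv+xw : ∀ {x u v w} → 0ℤ ≤ x → 0ℤ ≤ u → 0ℤ ≤ v → 1ℤ ≤ w → x ≤ u * v + x * w
x≤uv+xw {x} {u} {v} {w} 0≤x 0≤u 0≤v 1≤w = i≤j⇒i≤k+j (u * v) {{nonNegative 0≤uv}} x≤xw
  where
  x≤xw : x ≤ x * w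
  x≤xw = subst (_≤ x * w) (*-identityʳ x) (*-monoˡ-≤-nonNeg x {{nonNegative 0≤x}} 1≤w)
  0≤uv : 0ℤ ≤ u * v
  0≤uv = subst (_≤ u * v) (*-zeroʳ u) (*-monoˡ-≤-nonNeg u {{nonNegative 0≤u}} 0≤v)

δ-·-mono : ∀ A B → WordBounds A → WordBounds B → δ A ≤ δ (A · B)
δ-·-mono (mat p q r s) (mat p′ q′ r′ s′) (_ , _ , 0≤r , 1≤s) (_ , 0≤q′ , _ , 1≤s′) =
  x≤uv+xw (1≤i⇒0≤i 1≤s) 0≤r 0≤q′ 1≤s′

β+γ-·-mono : ∀ A B → WordBounds A → WordBounds B → β A + γ A ≤ β (A · B) + γ (A · B)
β+γ-·-mono (mat p q r s) (mat p′ q′ r′ s′) (1≤p , 0≤q , 0≤r , 1≤s) (1≤p′ , 0≤q′ , 0≤r′ , 1≤s′) =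
  +-mono-≤ (x≤uv+xw 0≤q (1≤i⇒0≤i 1≤p) 0≤q′ 1≤s′)
           (subst (r ≤_) (+-comm (s * r′) (r * p′)) (x≤uv+xw 0≤r (1≤i⇒0≤i 1≤s) 0≤r′ 1≤p′))

natMat : ℕ → ℕ → ℕ → ℕ → Mat
natMat x y z w = mat (+ x) (+ y) (+ z) (+ w)

matL-natMat : ∀ x y z w → matL · natMat x y z w ≡ natMat (z ℕ.+ x) (w ℕ.+ y) z w
matL-natMat x y z w = trans (matL-· (natMat x y z w)) (Mat-≡ (sym (pos-+ z x)) (sym (pos-+ w y)) refl refl)

matR-natMat : ∀ x y z w → matR · natMat x y z w ≡ natMat x y (x ℕ.+ z) (y ℕ.+ w)
matR-natMat x y z w = trans (matR-· (natMat x y z w)) (Mat-≡ refl refl (sym (pos-+ x z)) (sym (pos-+ y w)))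

det1⇒0<z+w : ∀ x y z w → x ℕ.* w ≡ y ℕ.* z ℕ.+ 1 → 0 ℕ.< z ℕ.+ w
det1⇒0<z+w x y (suc _) w     _ = s≤s z≤n
det1⇒0<z+w x y zero (suc _)  _ = s≤s z≤n
det1⇒0<z+w x y zero zero det≡1 =
  ⊥-elim (ℕₚ.0≢1+n (trans (sym (ℕₚ.*-zeroʳ x)) (trans det≡1 (ℕₚ.+-comm (y ℕ.* 0) 1))))

det1⇒0<x+y : ∀ x y z w → x ℕ.* w ≡ y ℕ.* z ℕ.+ 1 → 0 ℕ.< x ℕ.+ y
det1⇒0<x+y (suc _) y z w _ = s≤s z≤n
det1⇒0<x+y zero (suc _) z w _ = s≤s z≤n
det1⇒0<x+y zero zero z w ()

module _ {x y z w : ℕ} (det≡1 : x ℕ.* w ≡ y ℕ.* z ℕ.+ 1) where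

  det1-diagonal : z ℕ.< x → y ℕ.< w → x ≡ 1 × y ≡ 0 × z ≡ 0 × w ≡ 1
  det1-diagonal z<x y<w = ℕₚ.m*n≡1⇒m≡1 x w xw≡1 , y≡0 , z≡0 , ℕₚ.m*n≡1⇒n≡1 x w xw≡1
    where
    expand : ∀ y z → suc z ℕ.* suc y ≡ y ℕ.* z ℕ.+ 1 ℕ.+ (y ℕ.+ z)
    expand = ℕSolver.solve-∀
    y+z≤0 : y ℕ.+ z ℕ.≤ 0
    y+z≤0 = ℕₚ.+-cancelˡ-≤ (y ℕ.* z ℕ.+ 1) _ _
      (subst₂ ℕ._≤_ (expand y z) (trans det≡1 (sym (ℕₚ.+-identityʳ _))) (ℕₚ.*-mono-≤ z<x y<w))
    y≡0 : y ≡ 0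
    y≡0 = ℕₚ.n≤0⇒n≡0 (ℕₚ.m+n≤o⇒m≤o y y+z≤0)
    z≡0 : z ≡ 0
    z≡0 = ℕₚ.n≤0⇒n≡0 (ℕₚ.m+n≤o⇒n≤o y y+z≤0)
    xw≡1 : x ℕ.* w ≡ 1
    xw≡1 = trans det≡1 (cong₂ (λ u v → u ℕ.* v ℕ.+ 1) y≡0 z≡0)

  ¬det1-antidiagonal : x ℕ.< z → w ℕ.< y → ⊥
  ¬det1-antidiagonal x<z w<y = ℕₚ.<-irrefl refl (ℕₚ.<-≤-trans yz<xw+1+[x+w] (subst (ℕ._≤ y ℕ.* z) (expand x w) (ℕₚ.*-mono-≤ w<y x<z)))
    where
    expand : ∀ x w → suc w ℕ.* suc x ≡ x ℕ.* w ℕ.+ 1 ℕ.+ (x ℕ.+ w)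
    expand = ℕSolver.solve-∀
    yz<xw+1+[x+w] : y ℕ.* z ℕ.< x ℕ.* w ℕ.+ 1 ℕ.+ (x ℕ.+ w)
    yz<xw+1+[x+w] = ℕₚ.<-≤-trans (subst (y ℕ.* z ℕ.<_) (sym det≡1) (ℕₚ.m<m+n (y ℕ.* z) (s≤s z≤n)))
                      (ℕₚ.≤-trans (ℕₚ.m≤m+n (x ℕ.* w) 1) (ℕₚ.m≤m+n (x ℕ.* w ℕ.+ 1) (x ℕ.+ w)))

-- Euclid's algorithm on the rows: subtract the smaller row from the larger until the identity is reached.
natMat-word : ∀ {x y z w} → Acc ℕ._<_ (x ℕ.+ y ℕ.+ z ℕ.+ w) → x ℕ.* w ≡ y ℕ.* z ℕ.+ 1 →
  ∃[ W ] wordMat W ≡ natMat x y z w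
natMat-word {x} {y} {z} {w} (acc rec) det≡1 with z ℕ.≤? x | w ℕ.≤? y | x ℕ.≤? z | y ℕ.≤? w
... | yes z≤x | yes w≤y | _ | _ with ℕₚ.m≤n⇒∃[o]m+o≡n z≤x | ℕₚ.m≤n⇒∃[o]m+o≡n w≤y
...   | x′ , refl | y′ , refl = L ∷ W , trans (cong (matL ·_) W≡) (matL-natMat x′ y′ z w)
  where
  det′ : x′ ℕ.* w ≡ y′ ℕ.* z ℕ.+ 1
  det′ = ℕₚ.+-cancelˡ-≡ (z ℕ.* w) _ _ (trans (sym (expand₁ z x′ w)) (trans det≡1 (expand₂ w y′ z)))
    where
    expand₁ : ∀ z x′ w → (z ℕ.+ x′) ℕ.* w ≡ z ℕ.* w ℕ.+ x′ ℕ.* w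
    expand₁ = ℕSolver.solve-∀
    expand₂ : ∀ w y′ z → (w ℕ.+ y′) ℕ.* z ℕ.+ 1 ≡ z ℕ.* w ℕ.+ (y′ ℕ.* z ℕ.+ 1)
    expand₂ = ℕSolver.solve-∀
  smaller : x′ ℕ.+ y′ ℕ.+ z ℕ.+ w ℕ.< (z ℕ.+ x′) ℕ.+ (w ℕ.+ y′) ℕ.+ z ℕ.+ w
  smaller = subst (x′ ℕ.+ y′ ℕ.+ z ℕ.+ w ℕ.<_) (sym (size x′ y′ z w)) (ℕₚ.m<m+n _ (det1⇒0<z+w x′ y′ z w det′))
    where
    size : ∀ x′ y′ z w → (z ℕ.+ x′) ℕ.+ (w ℕ.+ y′) ℕ.+ z ℕ.+ w ≡ x′ ℕ.+ y′ ℕ.+ z ℕ.+ w ℕ.+ (z ℕ.+ w)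
    size = ℕSolver.solve-∀
  recursive = natMat-word {x′} {y′} {z} {w} (rec smaller) det′
  W = recursive .proj₁
  W≡ = recursive .proj₂
natMat-word {x} {y} {z} {w} (acc rec) det≡1
  | _ | _ | yes x≤z | yes y≤w with ℕₚ.m≤n⇒∃[o]m+o≡n x≤z | ℕₚ.m≤n⇒∃[o]m+o≡n y≤w
...   | z′ , refl | w′ , refl = R ∷ W , trans (cong (matR ·_) W≡) (matR-natMat x y z′ w′)
  where
  det′ : x ℕ.* w′ ≡ y ℕ.* z′ ℕ.+ 1
  det′ = ℕₚ.+-cancelˡ-≡ (x ℕ.* y) _ _ (trans (sym (expand₁ x y w′)) (trans det≡1 (expand₂ x y z′)))
    where
    expand₁ : ∀ x y w′ → x ℕ.* (y ℕ.+ w′) ≡ x ℕ.* y ℕ.+ x ℕ.* w′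
    expand₁ = ℕSolver.solve-∀
    expand₂ : ∀ x y z′ → y ℕ.* (x ℕ.+ z′) ℕ.+ 1 ≡ x ℕ.* y ℕ.+ (y ℕ.* z′ ℕ.+ 1)
    expand₂ = ℕSolver.solve-∀
  smaller : x ℕ.+ y ℕ.+ z′ ℕ.+ w′ ℕ.< x ℕ.+ y ℕ.+ (x ℕ.+ z′) ℕ.+ (y ℕ.+ w′)
  smaller = subst (x ℕ.+ y ℕ.+ z′ ℕ.+ w′ ℕ.<_) (sym (size x y z′ w′)) (ℕₚ.m<m+n _ (det1⇒0<x+y x y z′ w′ det′))
    where
    size : ∀ x y z′ w′ → x ℕ.+ y ℕ.+ (x ℕ.+ z′) ℕ.+ (y ℕ.+ w′) ≡ x ℕ.+ y ℕ.+ z′ ℕ.+ w′ ℕ.+ (x ℕ.+ y)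
    size = ℕSolver.solve-∀
  recursive = natMat-word {x} {y} {z′} {w′} (rec smaller) det′
  W = recursive .proj₁
  W≡ = recursive .proj₂
natMat-word {x} {y} {z} {w} (acc rec) det≡1
  | _ | no w≰y | _ | no y≰w = ⊥-elim (ℕₚ.<-asym (ℕₚ.≰⇒> w≰y) (ℕₚ.≰⇒> y≰w))
natMat-word {x} {y} {z} {w} (acc rec) det≡1
  | no z≰x | _ | no x≰z | _ = ⊥-elim (ℕₚ.<-asym (ℕₚ.≰⇒> z≰x) (ℕₚ.≰⇒> x≰z))
natMat-word {x} {y} {z} {w} (acc rec) det≡1
  | yes _ | no w≰y | no x≰z | yes _ with det1-diagonal det≡1 (ℕₚ.≰⇒> x≰z) (ℕₚ.≰⇒> w≰y)
...   | refl , refl , refl , refl = [] , refl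
natMat-word {x} {y} {z} {w} (acc rec) det≡1
  | no z≰x | yes _ | yes _ | no y≰w = ⊥-elim (¬det1-antidiagonal det≡1 (ℕₚ.≰⇒> z≰x) (ℕₚ.≰⇒> y≰w))

nonNegative-SL₂-word : ∀ M → 0ℤ ≤ α M → 0ℤ ≤ β M → 0ℤ ≤ γ M → 0ℤ ≤ δ M → det M ≡ 1ℤ → ∃[ W ] wordMat W ≡ M
nonNegative-SL₂-word (mat (+ x) (+ y) (+ z) (+ w)) (+≤+ _) (+≤+ _) (+≤+ _) (+≤+ _) det≡1 =
  natMat-word (<-wellFounded _) (+-injective (begin
    + (x ℕ.* w)                        ≡⟨ pos-* x w ⟩
    xw                                 ≡⟨ identity xw yz ⟩
    (xw - yz) + yz                     ≡⟨ cong (_+ yz) det≡1 ⟩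
    1ℤ + yz                            ≡⟨ cong (λ v → 1ℤ + v) (sym (pos-* y z)) ⟩
    + (1 ℕ.+ y ℕ.* z)                  ≡⟨ cong +_ (ℕₚ.+-comm 1 (y ℕ.* z)) ⟩
    + (y ℕ.* z ℕ.+ 1)                  ∎))
  where
  open ≡-Reasoning
  xw = (+ x) * (+ w)
  yz = (+ y) * (+ z)
  identity : ∀ i j → i ≡ (i - j) + j
  identity = solve-∀

-- From a Pell solution to a word

-- Modulo 4 the equation reads t² ≡ b²u², so t ≡ b u (mod 2).
Pell-parity : ∀ {a b c t u} → PellSol (b * b - (+ 4) * a * c) t u → ∃[ k ] t ≡ (+ 2) * k + b * u
Pell-parity {a} {b} {c} {t} {u} pell = k , t≡2k+bu (ℕₚ.n≤1⇒n≡0∨n≡1 (ℕ.s≤s⁻¹ (n%ℕd<d (t - b * u) 2)))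
  where
  k = (t - b * u) /ℕ 2
  ρ = (t - b * u) %ℕ 2
  t≡ρ+2k+bu : t ≡ (+ ρ + k * (+ 2)) + b * u
  t≡ρ+2k+bu = trans (identity t (b * u)) (cong (_+ b * u) (a≡a%ℕn+[a/ℕn]*n (t - b * u) 2))
    where
    identity : ∀ t x → t ≡ (t - x) + x
    identity = solve-∀
  t≡2k+bu : ρ ≡ 0 ⊎ ρ ≡ 1 → t ≡ (+ 2) * k + b * u
  t≡2k+bu (inj₁ ρ≡0) = trans t≡ρ+2k+bu (trans (cong (λ r → (+ r + k * (+ 2)) + b * u) ρ≡0) (identity k (b * u)))
    where
    identity : ∀ k x → (+ 0 + k * (+ 2)) + x ≡ (+ 2) * k + x
    identity = solve-∀
  t≡2k+bu (inj₂ ρ≡1) = ⊥-elim (2*i≢-1 _ (trans (identity a b c k u)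
    (trans (cong (λ v → - 1ℤ + v) (i≡j⇒i-j≡0 pell′)) (+-identityʳ (- 1ℤ)))))
    where
    pell′ : PellSol (b * b - (+ 4) * a * c) ((+ 1 + k * (+ 2)) + b * u) u
    pell′ = subst (λ v → PellSol (b * b - (+ 4) * a * c) v u) (trans t≡ρ+2k+bu (cong (λ r → (+ r + k * (+ 2)) + b * u) ρ≡1)) pell
    identity : ∀ a b c k u →
      (+ 2) * ((+ 2) * k + (+ 2) * k * k + b * u + (+ 2) * k * b * u - (+ 2) * (- 1ℤ - a * c * u * u))
      ≡ - 1ℤ + (((+ 1 + k * (+ 2)) + b * u) * ((+ 1 + k * (+ 2)) + b * u) - (b * b - (+ 4) * a * c) * u * u - (- (+ 4)))
    identity = solve-∀

acuu≤-1 : ∀ a c u → 0ℤ < a → c < 0ℤ → 0ℤ < u → a * c * u * u ≤ - 1ℤ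
acuu≤-1 +[1+ _ ] -[1+ _ ] +[1+ _ ] _ _ _ = -≤- z≤n
acuu≤-1 +0 _ _ (+<+ ()) _ _
acuu≤-1 _ (+ _) _ _ (+<+ ()) _
acuu≤-1 _ _ +0 _ _ (+<+ ())
acuu≤-1 _ _ -[1+ _ ] _ _ ()

-- With t = 2k + b u the Pell equation t² - D u² = -4 becomes k (k + b u) + a c u² + 1 = 0.
Pell-matrix : ∀ a b c k u → k * (k + b * u) + (a * c * u * u + 1ℤ) ≡ 0ℤ →
  let M = mat (- (c * u)) k (k + b * u) (a * u) in [ a , b , c ] ∣ᶠ M ≡ negDual [ a , b , c ] × det M ≡ 1ℤ
Pell-matrix a b c k u E≡0 =
  Form-≡ (i+j≡0⇒j≡-i (trans (coeff₀ a b c k u) (scaled c))) (i+j≡0⇒j≡-i (trans (coeff₁ a b c k u) (scaled b)))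
         (i+j≡0⇒j≡-i (trans (coeff₂ a b c k u) (scaled a))) ,
  i-j≡0⇒i≡j _ _ (trans (determinant a b c k u) (cong ((- 1ℤ) *_) E≡0))
  where
  E = k * (k + b * u) + (a * c * u * u + 1ℤ)
  scaled : ∀ x → x * E ≡ 0ℤ
  scaled x = trans (cong (x *_) E≡0) (*-zeroʳ x)
  coeff₀ : ∀ a b c k u → c + (a * (- (c * u)) * (- (c * u)) + b * (- (c * u)) * (k + b * u) + c * (k + b * u) * (k + b * u))
    ≡ c * (k * (k + b * u) + (a * c * u * u + 1ℤ))
  coeff₀ = solve-∀
  coeff₁ : ∀ a b c k u → b + ((+ 2) * a * (- (c * u)) * k + b * ((- (c * u)) * (a * u) + k * (k + b * u)) + (+ 2) * c * (k + b * u) * (a * u))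
    ≡ b * (k * (k + b * u) + (a * c * u * u + 1ℤ))
  coeff₁ = solve-∀
  coeff₂ : ∀ a b c k u → a + (a * k * k + b * k * (a * u) + c * (a * u) * (a * u))
    ≡ a * (k * (k + b * u) + (a * c * u * u + 1ℤ))
  coeff₂ = solve-∀
  determinant : ∀ a b c k u → (- (c * u)) * (a * u) - k * (k + b * u) - 1ℤ ≡ (- 1ℤ) * (k * (k + b * u) + (a * c * u * u + 1ℤ))
  determinant = solve-∀

Pell⇒word : ∀ f t u → 0ℤ < a f → c f < 0ℤ → 0ℤ ≤ t → 0ℤ < u → PellSol (disc f) t u →
  ∃[ W ] f ∣ᶠ wordMat W ≡ negDual f × δ (wordMat W) ≡ a f * u × β (wordMat W) + γ (wordMat W) ≡ t
Pell⇒word [ a , b , c ] t u 0<a c<0 0≤t 0<u pell with Pell-parity {a} {b} {c} {t} {u} pell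
... | k , refl = W , trans (cong ([ a , b , c ] ∣ᶠ_) W≡M) (Pell-matrix a b c k u E≡0 .proj₁) ,
                 cong δ W≡M , trans (cong₂ _+_ (cong β W≡M) (cong γ W≡M)) (k+[k+bu]≡2k+bu k (b * u))
  where
  k+[k+bu]≡2k+bu : ∀ k x → k + (k + x) ≡ (+ 2) * k + x
  k+[k+bu]≡2k+bu = solve-∀
  E≡0 : k * (k + b * u) + (a * c * u * u + 1ℤ) ≡ 0ℤ
  E≡0 with i*j≡0⇒i≡0∨j≡0 (+ 4) (trans (identity a b c k u) (i≡j⇒i-j≡0 pell))
    where
    identity : ∀ a b c k u → (+ 4) * (k * (k + b * u) + (a * c * u * u + 1ℤ))
      ≡ ((+ 2) * k + b * u) * ((+ 2) * k + b * u) - (b * b - (+ 4) * a * c) * u * u - (- (+ 4))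
    identity = solve-∀
  ... | inj₂ E≡0 = E≡0
  M = mat (- (c * u)) k (k + b * u) (a * u)
  0≤k[k+bu] : 0ℤ ≤ k * (k + b * u)
  0≤k[k+bu] = subst (0ℤ ≤_) (sym (i+j≡0⇒j≡-i (trans (+-comm (a * c * u * u + 1ℤ) (k * (k + b * u))) E≡0)))
    (neg-mono-≤ (+-monoˡ-≤ 1ℤ (acuu≤-1 a c u 0<a c<0 0<u)))
  0≤k∧0≤k+bu : 0ℤ ≤ k × 0ℤ ≤ k + b * u
  0≤k∧0≤k+bu = 0≤i*j∧0≤i+j⇒0≤i∧0≤j k (k + b * u) 0≤k[k+bu] (subst (0ℤ ≤_) (sym (k+[k+bu]≡2k+bu k (b * u))) 0≤t)
  factor = nonNegative-SL₂-word M
    (<⇒≤ (neg-mono-< (*-monoʳ-<-pos u {{positive 0<u}} c<0))) (0≤k∧0≤k+bu .proj₁) (0≤k∧0≤k+bu .proj₂)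
    (<⇒≤ (*-monoʳ-<-pos u {{positive 0<u}} 0<a)) (Pell-matrix a b c k u E≡0 .proj₂)
  W = factor .proj₁
  W≡M = factor .proj₂

-- The river of a form with a > 0 > c

module _ {q n w} (P : RiverPeriod q n w) (rf : RiverForm q) where
  open RiverPeriod P

  q≢negDual : q ≢ negDual q
  q≢negDual = ≢negDual q (rf .proj₂ .proj₂)

  Pell⇒River : ∀ {t u} → 0ℤ ≤ t → 0ℤ < u → PellSol (disc q) t u →
    ∃[ W ] River (length W) q W (negDual q) × δ (wordMat W) ≡ a q * u × β (wordMat W) + γ (wordMat W) ≡ t
  Pell⇒River {t} {u} 0≤t 0<u pell with Pell⇒word q t u (rf .proj₁) (rf .proj₂ .proj₁) 0≤t 0<u pell
  ... | W , q∣W≡q′ , δ≡au , β+γ≡t = W , River-of-∣ᶠ W rf (RiverForm-negDual {q} rf) q∣W≡q′ , δ≡au , β+γ≡t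

  Pell⇒split : ∀ {t u} → PellSol (disc q) t u → ∃[ X ] w ≡ X ++ bar X
  Pell⇒split {t} {u} pell = split (∣ u ∣) refl
    where
    split : ∀ m → ∣ u ∣ ≡ m → ∃[ X ] w ≡ X ++ bar X
    split zero |u|≡0 = ⊥-elim (¬PellSol-u≡0 {disc q} {t} (subst (PellSol (disc q) t) (∣i∣≡0⇒i≡0 |u|≡0) pell))
    split (suc _) |u|≡1+m
      with Pell⇒River {+ ∣ t ∣} {+ ∣ u ∣} (+≤+ z≤n) (subst (λ m → 0ℤ < + m) (sym |u|≡1+m) (+<+ (s≤s z≤n)))
                      (PellSol-abs {disc q} {t} {u} pell)
    ... | _ , river , _ = reaches-negDual⇒split P q≢negDual river

  split-nonEmpty : ∀ X → w ≡ X ++ bar X → ∃[ x ] ∃[ X₀ ] X ≡ x ∷ X₀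
  split-nonEmpty (x ∷ X₀) _ = x , X₀ , refl
  split-nonEmpty [] w≡[] = ⊥-elim (ℕₚ.<-irrefl (trans (cong length (sym w≡[])) (River-length loop)) nonEmpty)

  module _ (X : List Letter) (w≡XX̄ : w ≡ X ++ bar X) where

    half-river : ∃[ q′ ] River (length X) q X q′ × River (length (bar X)) q′ (bar X) q
    half-river = River-split-++ X (subst (λ v → River n q v q) w≡XX̄ loop)

    -- Applying negDual to both stretches q →X→ q′ →X̄→ q shows that the automorph X̄X of q′
    -- also fixes -q*; as its γ is positive, q′ = -q*.
    half-∣ᶠ : 0ℤ < disc q → q ∣ᶠ wordMat X ≡ negDual q
    half-∣ᶠ 0<D with half-river
    ... | q′ , river₁ , river₂ = trans q∣X≡q′ (automorph-determines-form q′ (negDual q) N q′-fixed negDual-fixed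
      (det-wordMat (bar X ++ X)) 0<γN disc≡ (subst (0ℤ <_) (sym disc-q′) 0<D)
      (RiverForm-River rf river₁ .proj₁) (RiverForm-negDual {q} rf .proj₁))
      where
      open ≡-Reasoning
      N = wordMat (bar X ++ X)
      q∣X≡q′ : q ∣ᶠ wordMat X ≡ q′
      q∣X≡q′ = River-∣ᶠ river₁
      q′∣X̄≡q : q′ ∣ᶠ wordMat (bar X) ≡ q
      q′∣X̄≡q = River-∣ᶠ river₂
      q′-fixed : q′ ∣ᶠ N ≡ q′
      q′-fixed = begin
        q′ ∣ᶠ N                               ≡⟨ ∣ᶠ-wordMat-++ q′ (bar X) X ⟩
        (q′ ∣ᶠ wordMat (bar X)) ∣ᶠ wordMat X  ≡⟨ cong (_∣ᶠ wordMat X) q′∣X̄≡q ⟩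
        q ∣ᶠ wordMat X                        ≡⟨ q∣X≡q′ ⟩
        q′                                    ∎
      negDual-fixed : negDual q ∣ᶠ N ≡ negDual q
      negDual-fixed = begin
        negDual q ∣ᶠ N                                      ≡⟨ ∣ᶠ-wordMat-++ (negDual q) (bar X) X ⟩
        (negDual q ∣ᶠ wordMat (bar X)) ∣ᶠ wordMat X         ≡⟨ cong (_∣ᶠ wordMat X) (negDual-∣ᶠ-wordMat q X) ⟩
        negDual (q ∣ᶠ wordMat X) ∣ᶠ wordMat X               ≡⟨ cong (λ g → negDual g ∣ᶠ wordMat X) q∣X≡q′ ⟩
        negDual q′ ∣ᶠ wordMat X                             ≡⟨ cong (λ V → negDual q′ ∣ᶠ wordMat V) (sym (bar-involutive X)) ⟩
        negDual q′ ∣ᶠ wordMat (bar (bar X))                 ≡⟨ negDual-∣ᶠ-wordMat q′ (bar X) ⟩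
        negDual (q′ ∣ᶠ wordMat (bar X))                     ≡⟨ cong negDual q′∣X̄≡q ⟩
        negDual q                                           ∎
      0<γN : 0ℤ < γ N
      0<γN with split-nonEmpty X w≡XX̄
      ... | x , X₀ , refl = suc[i]≤j⇒i<j (1≤γ-wordMat-bar-++ x X₀)
      disc-q′ : disc q′ ≡ disc q
      disc-q′ = trans (cong disc (sym q∣X≡q′)) (disc-∣ᶠ-SL q (wordMat X) (det-wordMat X))
      disc≡ : disc q′ ≡ disc (negDual q)
      disc≡ = trans disc-q′ (sym (disc-negDual q))

    -- Every positive solution comes from a stretch of river from q to -q*, which begins with X;
    -- the entries β + γ and δ only grow along the river.
    half-minimal-Pell : ∀ u → 0ℤ ≤ u → δ (wordMat X) ≡ a q * u ⊎ δ (wordMat X) ≡ - (a q * u) →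
      PellSol (disc q) (β (wordMat X) + γ (wordMat X)) u → IsMinPosPellSol (disc q) (β (wordMat X) + γ (wordMat X)) u
    half-minimal-Pell u 0≤u δ≡±au pell = 0<t , 0<u , pell , minimal-solution
      where
      MX = wordMat X
      boundsX = wordMat-bounds X
      1≤δ : 1ℤ ≤ δ MX
      1≤δ = boundsX .proj₂ .proj₂ .proj₂
      0≤au : 0ℤ ≤ a q * u
      0≤au = subst (_≤ a q * u) (*-zeroʳ (a q)) (*-monoˡ-≤-nonNeg (a q) {{nonNegative (<⇒≤ (rf .proj₁))}} 0≤u)
      δ≡au : δ MX ≡ a q * u
      δ≡au = positive-branch δ≡±au
        where
        positive-branch : δ MX ≡ a q * u ⊎ δ MX ≡ - (a q * u) → δ MX ≡ a q * u
        positive-branch (inj₁ δ≡au) = δ≡au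
        positive-branch (inj₂ δ≡-au) =
          ⊥-elim (<-irrefl refl (≤-<-trans (subst (1ℤ ≤_) δ≡-au 1≤δ) (≤-<-trans (neg-mono-≤ 0≤au) (+<+ (s≤s z≤n)))))
      0<u : 0ℤ < u
      0<u = positive-gcd u 0≤u δ≡au
        where
        positive-gcd : ∀ v → 0ℤ ≤ v → δ MX ≡ a q * v → 0ℤ < v
        positive-gcd +[1+ _ ] _ _ = +<+ (s≤s z≤n)
        positive-gcd +0 _ δ≡a0 = ⊥-elim (<-irrefl refl (≤-<-trans (subst (1ℤ ≤_) (trans δ≡a0 (*-zeroʳ (a q))) 1≤δ) (+<+ (s≤s z≤n))))
        positive-gcd -[1+ _ ] () _
      0<t : 0ℤ < β MX + γ MX
      0<t with split-nonEmpty X w≡XX̄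
      ... | x , X₀ , refl = suc[i]≤j⇒i<j (1≤β+γ-wordMat x X₀)
      minimal-solution : ∀ t′ u′ → 0ℤ < t′ → 0ℤ < u′ → PellSol (disc q) t′ u′ → β MX + γ MX ≤ t′ × u ≤ u′
      minimal-solution t′ u′ 0<t′ 0<u′ pell′ with Pell⇒River {t′} {u′} (<⇒≤ 0<t′) 0<u′ pell′
      ... | W , river , δW≡au′ , βγW≡t′ with ℕₚ.m≤n⇒∃[o]m+o≡n (half-length≤ P X q≢negDual w≡XX̄ river)
      ... | k , |X|+k≡|W| with River-splitAt (length X) (subst (λ m → River m q W (negDual q)) (sym |X|+k≡|W|) river)
      ... | W₁ , W₂ , _ , refl , river₁ , _ with River-deterministic (half-river .proj₂ .proj₁) river₁
      ... | refl , _ =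
        subst (β MX + γ MX ≤_) β+γ[XV]≡t′ (β+γ-·-mono MX V boundsX (wordMat-bounds W₂)) ,
        *-cancelˡ-≤-pos u u′ (a q) {{positive (rf .proj₁)}} (subst₂ _≤_ δ≡au δ[XV]≡au′ (δ-·-mono MX V boundsX (wordMat-bounds W₂)))
        where
        V = wordMat W₂
        W≡XV : wordMat (X ++ W₂) ≡ MX · V
        W≡XV = wordMat-++ X W₂
        β+γ[XV]≡t′ : β (MX · V) + γ (MX · V) ≡ t′
        β+γ[XV]≡t′ = trans (cong (λ M → β M + γ M) (sym W≡XV)) βγW≡t′
        δ[XV]≡au′ : δ (MX · V) ≡ a q * u′
        δ[XV]≡au′ = trans (cong δ (sym W≡XV)) δW≡au′

    half-Pell : Primitive q → 0ℤ < disc q →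
      IsMinPosPellSol (disc q) (β (wordMat X) + γ (wordMat X))
        (gcd (gcd (δ (wordMat X)) (γ (wordMat X) - β (wordMat X))) (α (wordMat X)))
    half-Pell coprime 0<D = half-minimal-Pell _ (+≤+ z≤n) (antiautomorph .proj₁) (antiautomorph .proj₂)
      where
      antiautomorph = antiautomorph-Pell q (colSwap (wordMat X)) coprime (rf .proj₁)
        (trans (∣ᶠ-colSwap q (wordMat X)) (cong _* (half-∣ᶠ 0<D))) (trans (det-colSwap (wordMat X)) (cong -_ (det-wordMat X)))

theorem8p14 : (q : Form) → Primitive q → 0ℤ < disc q → ¬ IsSquare (disc q) →
    0ℤ < a q → c q < 0ℤ →
    (w : List Letter) → RiverWord q w →
    q ∣ᶠ wordMat w ≡ q ×
    (∀ (X : List Letter) → w ≡ X ++ bar X →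
      q ∣ᶠ wordMat X ≡ negF (q *) ×
      IsMinPosPellSol (disc q) (β (wordMat X) + γ (wordMat X))
        (gcd (gcd (δ (wordMat X)) (γ (wordMat X) - β (wordMat X))) (α (wordMat X)))) ×
    ((¬ (∃[ X ] w ≡ X ++ bar X)) →
      ¬ (q ∼ negF (q *)) × ¬ (∃[ t ] ∃[ u ] PellSol (disc q) t u))
theorem8p14 q coprime 0<D nonSquare 0<a c<0 w riverWord =
  River-∣ᶠ (RiverPeriod.loop period) ,
  (λ X w≡XX̄ → half-∣ᶠ period rf X w≡XX̄ 0<D , half-Pell period rf X w≡XX̄ coprime 0<D) ,
  λ noSplit → (λ q∼q′ → noPell noSplit (∼negDual⇒Pell q coprime 0<a q∼q′)) , noPell noSplit
  where
  period = RiverWord⇒RiverPeriod riverWord .proj₂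
  rf : RiverForm q
  rf = 0<a , c<0 , nonSquare
  noPell : ¬ (∃[ X ] w ≡ X ++ bar X) → ¬ (∃[ t ] ∃[ u ] PellSol (disc q) t u)
  noPell noSplit (t , u , pell) = noSplit (Pell⇒split period rf {t} {u} pell)
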